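{- Let $\Lambda$ be a solid partition. Let $\mathcal R_\Lambda=\{R(i,j,k)\}$, $\mathcal Q_\Lambda=\{Q(i,j,k)\}$, $\mathcal R^\ast_\Lambda=\{R^\ast(i,j,k)\}$, $\mathcal Q^\ast_\Lambda=\{Q^\ast(i,j,k)\}$ be the multisets of these numbers over all $(i,j,k)\in\Lambda$. Then $\mathcal R_\Lambda$ majorizes $\mathcal R^\ast_\Lambda$, and $\mathcal Q_\Lambda$ majorizes $\mathcal Q^\ast_\Lambda$.
   Context: A solid partition $\Lambda$ is a finite subset of $\mathbb Z_{\ge0}^3$ that is a lower order ideal for the componentwise order: if $(i,j,k)\in\Lambda$ and $p\le i$, $q\le j$, $r\le k$ (with $p,q,r\ge0$), then $(p,q,r)\in\Lambda$. For $(i,j,k)\in\Lambda$ define $R(i,j,k)=\bigl|\{(p,j,k)\in\Lambda:i\le p\}\cup\{(i,q,k)\in\Lambda:j\le q\}\cup\{(i,j,r)\in\Lambda:k\le r\}\bigr|$, $Q(i,j,k)=\bigl|\{(p,q,k)\in\Lambda:i\le p,\ j\le q\}\cup\{(p,j,r)\in\Lambda:i\le p,\ k\le r\}\cup\{(i,q,r)\in\Lambda:j\le q,\ k\le r\}\bigr|$, and the anti-hooks $R^\ast,Q^\ast$ analogously with all inequalities reversed: $R^\ast(i,j,k)=\bigl|\{(p,j,k)\in\Lambda:p\le i\}\cup\{(i,q,k)\in\Lambda:q\le j\}\cup\{(i,j,r)\in\Lambda:r\le k\}\bigr|$, $Q^\ast(i,j,k)=\bigl|\{(p,q,k)\in\Lambda:p\le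 i,\ q\le j\}\cup\{(p,j,r)\in\Lambda:p\le i,\ r\le k\}\cup\{(i,q,r)\in\Lambda:q\le j,\ r\le k\}\bigr|$. Majorization: for two multisets $\mathcal A,\mathcal B$ of $n$ real numbers with elements $a_1\ge\dots\ge a_n$ and $b_1\ge\dots\ge b_n$ in non-increasing order, $\mathcal A$ majorizes $\mathcal B$ if $a_1+\dots+a_k\ge b_1+\dots+b_k$ for all $1\le k<n$ and $a_1+\dots+a_n=b_1+\dots+b_n$. -}

module Defs where

open import Data.Nat using (ℕ; _≤_; _<_; _≤?_; _≟_)
open import Data.Nat.Properties using (≤-decTotalOrder)
open import Data.Product using (_×_; _,_)
open import Data.Sum using (_⊎_)
open import Data.List using (List; map; length; take; filter)
open import Data.Nat.ListAction using (sum)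
open import Data.List.Membership.Propositional using (_∈_)
open import Data.List.Relation.Unary.Unique.Propositional using (Unique)
open import Relation.Binary.PropositionalEquality using (_≡_)
open import Relation.Nullary using (Dec)
open import Relation.Nullary.Decidable using (_×-dec_; _⊎-dec_)
import Relation.Binary.Construct.Flip.Ord as Flip
import Data.List.Sort as Sort

Cell : Set
Cell = ℕ × ℕ × ℕ

_≼_ : Cell → Cell → Set
(p , q , r) ≼ (i , j , k) = p ≤ i × q ≤ j × r ≤ k

-- A solid partition: a finite subset of Z_{≥0}^3 (given as a duplicate-free
-- list of its cells) which is a lower order ideal for the componentwise order.
record SolidPartition : Set where
  field
    cells  : List Cell
    unique : Unique cells
    lower  : ∀ {x y} → y ∈ cells → x ≼ y → x ∈ cells
open SolidPartition public

-- |{ y ∈ Λ : P y }| for a decidable predicate P (Λ is duplicate-free, so this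
-- is the cardinality of the subset).
count : (Λ : SolidPartition) (P : Cell → Set) → (∀ y → Dec (P y)) → ℕ
count Λ P P? = length (filter P? (cells Λ))

RHook : Cell → Cell → Set
RHook (i , j , k) (p , q , r) =
  (q ≡ j × r ≡ k × i ≤ p) ⊎ (p ≡ i × r ≡ k × j ≤ q) ⊎ (p ≡ i × q ≡ j × k ≤ r)

RHook? : ∀ x y → Dec (RHook x y)
RHook? (i , j , k) (p , q , r) =
  ((q ≟ j) ×-dec (r ≟ k) ×-dec (i ≤? p)) ⊎-dec
  ((p ≟ i) ×-dec (r ≟ k) ×-dec (j ≤? q)) ⊎-dec
  ((p ≟ i) ×-dec (q ≟ j) ×-dec (k ≤? r))

QHook : Cell → Cell → Set
QHook (i , j , k) (p , q , r) =
  (r ≡ k × i ≤ p × j ≤ q) ⊎ (q ≡ j × i ≤ p × k ≤ r) ⊎ (p ≡ i × j ≤ q × k ≤ r)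

QHook? : ∀ x y → Dec (QHook x y)
QHook? (i , j , k) (p , q , r) =
  ((r ≟ k) ×-dec (i ≤? p) ×-dec (j ≤? q)) ⊎-dec
  ((q ≟ j) ×-dec (i ≤? p) ×-dec (k ≤? r)) ⊎-dec
  ((p ≟ i) ×-dec (j ≤? q) ×-dec (k ≤? r))

R*Hook : Cell → Cell → Set
R*Hook (i , j , k) (p , q , r) =
  (q ≡ j × r ≡ k × p ≤ i) ⊎ (p ≡ i × r ≡ k × q ≤ j) ⊎ (p ≡ i × q ≡ j × r ≤ k)

R*Hook? : ∀ x y → Dec (R*Hook x y)
R*Hook? (i , j , k) (p , q , r) =
  ((q ≟ j) ×-dec (r ≟ k) ×-dec (p ≤? i)) ⊎-dec
  ((p ≟ i) ×-dec (r ≟ k) ×-dec (q ≤? j)) ⊎-dec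
  ((p ≟ i) ×-dec (q ≟ j) ×-dec (r ≤? k))

Q*Hook : Cell → Cell → Set
Q*Hook (i , j , k) (p , q , r) =
  (r ≡ k × p ≤ i × q ≤ j) ⊎ (q ≡ j × p ≤ i × r ≤ k) ⊎ (p ≡ i × q ≤ j × r ≤ k)

Q*Hook? : ∀ x y → Dec (Q*Hook x y)
Q*Hook? (i , j , k) (p , q , r) =
  ((r ≟ k) ×-dec (p ≤? i) ×-dec (q ≤? j)) ⊎-dec
  ((q ≟ j) ×-dec (p ≤? i) ×-dec (r ≤? k)) ⊎-dec
  ((p ≟ i) ×-dec (q ≤? j) ×-dec (r ≤? k))

R Q R* Q* : SolidPartition → Cell → ℕ
R  Λ x = count Λ (RHook x)  (RHook? x)
Q  Λ x = count Λ (QHook x)  (QHook? x)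
R* Λ x = count Λ (R*Hook x) (R*Hook? x)
Q* Λ x = count Λ (Q*Hook x) (Q*Hook? x)

-- Multisets {f(x) : x ∈ Λ}, represented as lists (order irrelevant below).
multiset : (Λ : SolidPartition) → (Cell → ℕ) → List ℕ
multiset Λ f = map f (cells Λ)

sortDesc : List ℕ → List ℕ
sortDesc = Sort.sort (Flip.decTotalOrder ≤-decTotalOrder)

Majorizes : List ℕ → List ℕ → Set
Majorizes A B =
  length A ≡ length B ×
  (∀ k → 1 ≤ k → k < length A →
     sum (take k (sortDesc B)) ≤ sum (take k (sortDesc A))) ×
  sum (sortDesc A) ≡ sum (sortDesc B)

-- A majorizes B iff both have the same sum and ∑ (a ∸ t) ≥ ∑ (b ∸ t) for every threshold t.
-- The sums agree by double counting: y lies in the hook of x exactly when x lies in the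
-- anti-hook of y. For the thresholds, view Λ through its indicator χ on a cube, in which every
-- axis-parallel line of Λ is an initial segment [0, ℓ). If u and z are antitone along such a
-- line, the values u c + c z c are dominated in excess by u c + ∑_{c<q<ℓ} z q, by convexity of
-- x ↦ x ∸ t. Doing this successively in the three directions turns the anti-hook lengths
-- R*(i,j,k) = 1 + i + j + k and Q*(i,j,k) = 1 + i + j + k + ij + ik + jk into the hook
-- lengths R and Q, written as sums over the cells beyond (i,j,k).

module Submission where

open import Defs
open import Data.Bool using (Bool; true; false; T; _∧_; _∨_; not)
open import Data.Bool.Properties using (T-∧)
open import Data.Empty using (⊥; ⊥-elim)
open import Data.List using (List; []; _∷_; map; take; length; filter)
open import Data.List.Membership.Propositional using (_∈_; _∉_)
open import Data.List.Properties using (length-map; map-∘; map-cong)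
open import Data.List.Relation.Binary.Permutation.Propositional using (_↭_)
open import Data.List.Relation.Binary.Permutation.Propositional.Properties using (map⁺; ↭-length)
open import Data.List.Relation.Binary.Pointwise using (Pointwise-≡⇒≡; []; _∷_)
open import Data.List.Relation.Unary.All using (All; []; _∷_)
open import Data.List.Relation.Unary.All.Properties using (All¬⇒¬Any)
open import Data.List.Relation.Unary.AllPairs using (_∷_)
open import Data.List.Relation.Unary.Any using (here; there; any?)
open import Data.List.Relation.Unary.Linked using (Linked; _∷_)
open import Data.List.Relation.Unary.Linked.Properties using (Linked⇒AllPairs)
open import Data.List.Relation.Unary.Unique.Propositional using (Unique)
open import Data.Nat using (ℕ; zero; suc; _+_; _*_; _∸_; _≤_; _≥_; _<_; z≤n; s≤s; s≤s⁻¹; _≡ᵇ_; _<ᵇ_; _≤ᵇ_)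
open import Data.Nat.ListAction using (sum)
open import Data.Nat.ListAction.Properties using (sum-↭)
open import Data.Nat.Properties
open import Data.Nat.Tactic.RingSolver using (solve-∀)
open import Data.Product using (∃-syntax; _×_; _,_; proj₁; proj₂)
open import Data.Sum using (inj₁; inj₂)
open import Function.Bundles using (Equivalence; mk⇔)
open import Relation.Binary.Core using (_Preserves_⟶_)
open import Relation.Binary.Definitions using (DecidableEquality)
open import Relation.Binary.PropositionalEquality
open import Relation.Nullary using (Dec; yes; no; does; ¬_)
open import Relation.Nullary.Decidable using (map′; _×-dec_; dec-true; dec-false; does-⇔)
import Algebra.Properties.CommutativeSemigroup +-commutativeSemigroup as +-CS
import Algebra.Properties.CommutativeSemigroup *-commutativeSemigroup as *-CS
import Data.List.Sort as Sort
import Relation.Binary.Construct.Flip.Ord as Flip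

open Sort (Flip.decTotalOrder ≤-decTotalOrder) using (sort-↭; sort-↗)

-- Iverson brackets and sums over initial ranges

𝟙 : Bool → ℕ
𝟙 true  = 1
𝟙 false = 0

𝟙≤1 : ∀ b → 𝟙 b ≤ 1
𝟙≤1 true  = ≤-refl
𝟙≤1 false = z≤n

𝟙-true : ∀ {b} → T b → 𝟙 b ≡ 1
𝟙-true {true} _ = refl

𝟙-false : ∀ {b} → ¬ T b → 𝟙 b ≡ 0
𝟙-false {true}  ¬t = ⊥-elim (¬t _)
𝟙-false {false} _  = refl

infix 4 ⟦_≐_⟧ ⟦_<_⟧ ⟦_≤_⟧

⟦_≐_⟧ ⟦_<_⟧ ⟦_≤_⟧ : ℕ → ℕ → ℕ
⟦ a ≐ b ⟧ = 𝟙 (a ≡ᵇ b)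
⟦ a < b ⟧ = 𝟙 (a <ᵇ b)
⟦ a ≤ b ⟧ = 𝟙 (a ≤ᵇ b)

⟦≐⟧-refl : ∀ a → ⟦ a ≐ a ⟧ ≡ 1
⟦≐⟧-refl a = 𝟙-true (≡⇒≡ᵇ a a refl)

⟦≐⟧-≢ : ∀ {a b} → a ≢ b → ⟦ a ≐ b ⟧ ≡ 0
⟦≐⟧-≢ {a} {b} a≢b = 𝟙-false (λ t → a≢b (≡ᵇ⇒≡ a b t))

⟦<⟧-< : ∀ {a b} → a < b → ⟦ a < b ⟧ ≡ 1
⟦<⟧-< a<b = 𝟙-true (<⇒<ᵇ a<b)

⟦<⟧-≥ : ∀ {a b} → b ≤ a → ⟦ a < b ⟧ ≡ 0
⟦<⟧-≥ {a} {b} b≤a = 𝟙-false (λ t → <⇒≱ (<ᵇ⇒< a b t) b≤a)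

⟦<⟧-antitoneˡ : ∀ {a a′} c → a ≤ a′ → ⟦ a′ < c ⟧ ≤ ⟦ a < c ⟧
⟦<⟧-antitoneˡ {a} {a′} c a≤a′ with a′ <? c
... | yes a′<c = ≤-reflexive (trans (⟦<⟧-< a′<c) (sym (⟦<⟧-< (≤-<-trans a≤a′ a′<c))))
... | no  a′≮c = ≤-trans (≤-reflexive (⟦<⟧-≥ {a′} (≮⇒≥ a′≮c))) z≤n

⟦≤⟧≡⟦<suc⟧ : ∀ a b → ⟦ a ≤ b ⟧ ≡ ⟦ a < suc b ⟧
⟦≤⟧≡⟦<suc⟧ zero    b = refl
⟦≤⟧≡⟦<suc⟧ (suc a) b = refl

∑ : ℕ → (ℕ → ℕ) → ℕ
∑ zero    f = 0
∑ (suc n) f = ∑ n f + f n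

syntax ∑ n (λ j → e) = ∑[ j < n ] e

∑-cong : ∀ n {f g} → (∀ j → j < n → f j ≡ g j) → ∑ n f ≡ ∑ n g
∑-cong zero    f≡g = refl
∑-cong (suc n) f≡g = cong₂ _+_ (∑-cong n (λ j j<n → f≡g j (m<n⇒m<1+n j<n))) (f≡g n ≤-refl)

∑-mono-≤ : ∀ n {f g} → (∀ j → j < n → f j ≤ g j) → ∑ n f ≤ ∑ n g
∑-mono-≤ zero    f≤g = z≤n
∑-mono-≤ (suc n) f≤g = +-mono-≤ (∑-mono-≤ n (λ j j<n → f≤g j (m<n⇒m<1+n j<n))) (f≤g n ≤-refl)

∑-zero : ∀ n {f} → (∀ j → j < n → f j ≡ 0) → ∑ n f ≡ 0
∑-zero zero    f≡0 = refl
∑-zero (suc n) f≡0 = cong₂ _+_ (∑-zero n (λ j j<n → f≡0 j (m<n⇒m<1+n j<n))) (f≡0 n ≤-refl)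

∑-distrib-+ : ∀ n f g → ∑[ j < n ] (f j + g j) ≡ ∑ n f + ∑ n g
∑-distrib-+ zero    f g = refl
∑-distrib-+ (suc n) f g =
  trans (cong (_+ (f n + g n)) (∑-distrib-+ n f g)) (+-CS.interchange (∑ n f) (∑ n g) (f n) (g n))

∑-*ˡ : ∀ n c f → ∑[ j < n ] (c * f j) ≡ c * ∑ n f
∑-*ˡ zero    c f = sym (*-zeroʳ c)
∑-*ˡ (suc n) c f = trans (cong (_+ c * f n) (∑-*ˡ n c f)) (sym (*-distribˡ-+ c (∑ n f) (f n)))

∑-const : ∀ n c → ∑[ _ < n ] c ≡ n * c
∑-const zero    c = refl
∑-const (suc n) c = trans (cong (_+ c) (∑-const n c)) (+-comm (n * c) c)

∑-comm : ∀ m n (F : ℕ → ℕ → ℕ) → ∑[ a < m ] ∑[ b < n ] F a b ≡ ∑[ b < n ] ∑[ a < m ] F a b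
∑-comm zero    n F = sym (∑-zero n (λ _ _ → refl))
∑-comm (suc m) n F = begin
  ∑[ a < m ] ∑[ b < n ] F a b + ∑[ b < n ] F m b ≡⟨ cong (_+ ∑ n (F m)) (∑-comm m n F) ⟩
  ∑[ b < n ] ∑[ a < m ] F a b + ∑[ b < n ] F m b ≡⟨ ∑-distrib-+ n (λ b → ∑[ a < m ] F a b) (F m) ⟨
  ∑[ b < n ] (∑[ a < m ] F a b + F m b)          ∎
  where open ≡-Reasoning

∑-prefix : ∀ n ℓ g → ℓ ≤ n → ∑[ j < n ] (⟦ j < ℓ ⟧ * g j) ≡ ∑ ℓ g
∑-prefix zero    .zero g z≤n = refl
∑-prefix (suc n) ℓ    g ℓ≤1+n with m≤n⇒m<n∨m≡n ℓ≤1+n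
... | inj₁ ℓ<1+n = begin
  ∑[ j < n ] (⟦ j < ℓ ⟧ * g j) + ⟦ n < ℓ ⟧ * g n
    ≡⟨ cong₂ _+_ (∑-prefix n ℓ g (s≤s⁻¹ ℓ<1+n)) (cong (_* g n) (⟦<⟧-≥ {n} {ℓ} (s≤s⁻¹ ℓ<1+n))) ⟩
  ∑ ℓ g + 0
    ≡⟨ +-identityʳ (∑ ℓ g) ⟩
  ∑ ℓ g ∎
  where open ≡-Reasoning
... | inj₂ refl = cong₂ _+_
  (∑-cong n (λ j j<n → trans (cong (_* g j) (⟦<⟧-< (m<n⇒m<1+n j<n))) (*-identityˡ (g j))))
  (trans (cong (_* g n) (⟦<⟧-< {n} ≤-refl)) (*-identityˡ (g n)))

∑-point : ∀ n i (g : ℕ → ℕ) → i < n → ∑[ j < n ] (⟦ j ≐ i ⟧ * g j) ≡ g i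
∑-point zero    i g ()
∑-point (suc n) i g i<1+n with m≤n⇒m<n∨m≡n (s≤s⁻¹ i<1+n)
... | inj₁ i<n = begin
  ∑[ j < n ] (⟦ j ≐ i ⟧ * g j) + ⟦ n ≐ i ⟧ * g n
    ≡⟨ cong₂ _+_ (∑-point n i g i<n) (cong (_* g n) (⟦≐⟧-≢ {n} {i} (λ n≡i → <-irrefl (sym n≡i) i<n))) ⟩
  g i + 0
    ≡⟨ +-identityʳ (g i) ⟩
  g i ∎
  where open ≡-Reasoning
... | inj₂ refl = begin
  ∑[ j < n ] (⟦ j ≐ n ⟧ * g j) + ⟦ n ≐ n ⟧ * g n
    ≡⟨ cong₂ _+_ (∑-zero n (λ j j<n → cong (_* g j) (⟦≐⟧-≢ {j} {n} (λ j≡n → <-irrefl j≡n j<n))))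
                 (cong (_* g n) (⟦≐⟧-refl n)) ⟩
  0 + 1 * g n
    ≡⟨ *-identityˡ (g n) ⟩
  g n ∎
  where open ≡-Reasoning

∑-below : ∀ n i (g : ℕ → ℕ) c → i ≤ n → (∀ j → j < i → g j ≡ c) → ∑[ j < n ] (⟦ j < i ⟧ * g j) ≡ i * c
∑-below n i g c i≤n g≡c = trans (∑-prefix n i g i≤n) (trans (∑-cong i g≡c) (∑-const i c))

∑-atOrBelow : ∀ n i (g : ℕ → ℕ) c → i < n → (∀ j → j ≤ i → g j ≡ c) →
  ∑[ j < n ] (⟦ j ≤ i ⟧ * g j) ≡ suc i * c
∑-atOrBelow n i g c i<n g≡c = trans (∑-cong n (λ j _ → cong (_* g j) (⟦≤⟧≡⟦<suc⟧ j i)))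
  (∑-below n (suc i) g c i<n (λ j j<1+i → g≡c j (s≤s⁻¹ j<1+i)))

-- Majorization through excesses over thresholds

sum-map-+ : ∀ {A : Set} (f g : A → ℕ) xs → sum (map (λ x → f x + g x) xs) ≡ sum (map f xs) + sum (map g xs)
sum-map-+ f g []       = refl
sum-map-+ f g (x ∷ xs) = trans (cong (f x + g x +_) (sum-map-+ f g xs)) (+-CS.interchange (f x) (g x) _ _)

sum-map-comm : ∀ {A B : Set} (f : A → B → ℕ) xs ys →
  sum (map (λ x → sum (map (f x) ys)) xs) ≡ sum (map (λ y → sum (map (λ x → f x y) xs)) ys)
sum-map-comm f []       ys = sym (sum-map-zero ys)
  where
  sum-map-zero : ∀ ys → sum (map (λ _ → 0) ys) ≡ 0
  sum-map-zero []       = refl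
  sum-map-zero (_ ∷ ys) = sum-map-zero ys
sum-map-comm f (x ∷ xs) ys = trans (cong (sum (map (f x) ys) +_) (sum-map-comm f xs ys))
  (sym (sum-map-+ (f x) (λ y → sum (map (λ x → f x y) xs)) ys))

excess : ℕ → List ℕ → ℕ
excess t xs = sum (map (_∸ t) xs)

excess-↭ : ∀ t {xs ys} → xs ↭ ys → excess t xs ≡ excess t ys
excess-↭ t xs↭ys = sum-↭ (map⁺ (_∸ t) xs↭ys)

excess-≤ : ∀ {t xs} → All (_≤ t) xs → excess t xs ≡ 0
excess-≤ []                = refl
excess-≤ (x≤t ∷ xs≤t) = cong₂ _+_ (m≤n⇒m∸n≡0 x≤t) (excess-≤ xs≤t)

sum-take≤ : ∀ t k xs → sum (take k xs) ≤ k * t + excess t xs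
sum-take≤ t zero    xs       = z≤n
sum-take≤ t (suc k) []       = z≤n
sum-take≤ t (suc k) (x ∷ xs) = begin
  x + sum (take k xs)                        ≤⟨ +-mono-≤ (m≤n+m∸n x t) (sum-take≤ t k xs) ⟩
  (t + (x ∸ t)) + (k * t + excess t xs)      ≡⟨ +-CS.interchange t (x ∸ t) (k * t) (excess t xs) ⟩
  (t + k * t) + ((x ∸ t) + excess t xs)      ∎
  where open ≤-Reasoning

-- For a non-increasing list the bound sum-take≤ is attained at t = the (k+1)-th element.
excess-tight-∷ : ∀ x xs k → Linked _≥_ (x ∷ xs) → k ≤ length xs →
  ∃[ t ] t ≤ x × suc k * t + excess t (x ∷ xs) ≤ sum (take (suc k) (x ∷ xs))
excess-tight-∷ x xs zero desc _ with Linked⇒AllPairs (λ z≤y y≤x → ≤-trans y≤x z≤y) desc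
... | xs≤x ∷ _ = x , ≤-refl , ≤-reflexive (begin
  (x + 0) + ((x ∸ x) + excess x xs) ≡⟨ cong₂ (λ a b → (x + 0) + (a + b)) (n∸n≡0 x) (excess-≤ xs≤x) ⟩
  (x + 0) + 0                       ≡⟨ +-identityʳ (x + 0) ⟩
  x + 0                             ∎)
  where open ≡-Reasoning
excess-tight-∷ x (y ∷ xs) (suc k) (y≤x ∷ desc) (s≤s k≤) with excess-tight-∷ y xs k desc k≤
... | t , t≤y , bound = t , t≤x , (begin
  (t + suc k * t) + ((x ∸ t) + excess t (y ∷ xs)) ≡⟨ +-CS.interchange t (suc k * t) (x ∸ t) _ ⟩
  (t + (x ∸ t)) + (suc k * t + excess t (y ∷ xs)) ≡⟨ cong (_+ _) (m+[n∸m]≡n t≤x) ⟩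
  x + (suc k * t + excess t (y ∷ xs))             ≤⟨ +-monoʳ-≤ x bound ⟩
  x + sum (take (suc k) (y ∷ xs))                 ∎)
  where
  open ≤-Reasoning
  t≤x : t ≤ x
  t≤x = ≤-trans t≤y y≤x

excess-tight : ∀ xs k → Linked _≥_ xs → suc k ≤ length xs →
  ∃[ t ] suc k * t + excess t xs ≤ sum (take (suc k) xs)
excess-tight (x ∷ xs) k desc (s≤s k≤) with excess-tight-∷ x xs k desc k≤
... | t , _ , bound = t , bound

majorizes-by-excess : ∀ xs ys → length xs ≡ length ys → sum xs ≡ sum ys →
  (∀ t → excess t ys ≤ excess t xs) → Majorizes xs ys
majorizes-by-excess xs ys |xs|≡|ys| Σxs≡Σys excess≤ =
  |xs|≡|ys| , partial-sums≤ , trans (sum-↭ (sort-↭ xs)) (trans Σxs≡Σys (sym (sum-↭ (sort-↭ ys))))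
  where
  partial-sums≤ : ∀ k → 1 ≤ k → k < length xs → sum (take k (sortDesc ys)) ≤ sum (take k (sortDesc xs))
  partial-sums≤ (suc k) _ k<|xs|
    with excess-tight (sortDesc xs) k (sort-↗ xs) (subst (suc k ≤_) (sym (↭-length (sort-↭ xs))) (<⇒≤ k<|xs|))
  ... | t , bound = begin
    sum (take (suc k) (sortDesc ys))       ≤⟨ sum-take≤ t (suc k) (sortDesc ys) ⟩
    suc k * t + excess t (sortDesc ys)     ≡⟨ cong (suc k * t +_) (excess-↭ t (sort-↭ ys)) ⟩
    suc k * t + excess t ys                ≤⟨ +-monoʳ-≤ (suc k * t) (excess≤ t) ⟩
    suc k * t + excess t xs                ≡⟨ cong (suc k * t +_) (excess-↭ t (sort-↭ xs)) ⟨
    suc k * t + excess t (sortDesc xs)     ≤⟨ bound ⟩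
    sum (take (suc k) (sortDesc xs))       ∎
    where open ≤-Reasoning

-- Rearrangement along a line

∸-superadditive : ∀ x y t → (x ∸ t) + (y ∸ t) ≤ (x + y) ∸ t
∸-superadditive x       y       zero    = ≤-refl
∸-superadditive zero    y       (suc t) = ≤-refl
∸-superadditive (suc x) zero    (suc t) = ≤-reflexive (trans (+-identityʳ (x ∸ t)) (cong (_∸ t) (sym (+-identityʳ x))))
∸-superadditive (suc x) (suc y) (suc t) = ≤-trans (∸-superadditive x y t) (∸-monoˡ-≤ t (+-monoʳ-≤ x (n≤1+n y)))

-- Convexity of _∸ t.
∸-exchange : ∀ c a e t → c ≤ a → ((c + e) ∸ t) + (a ∸ t) ≤ ((a + e) ∸ t) + (c ∸ t)
∸-exchange c a e zero c≤a = ≤-reflexive (begin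
  (c + e) + a ≡⟨ +-comm (c + e) a ⟩
  a + (c + e) ≡⟨ cong (a +_) (+-comm c e) ⟩
  a + (e + c) ≡⟨ +-assoc a e c ⟨
  (a + e) + c ∎)
  where open ≡-Reasoning
∸-exchange zero a e (suc t) _ = begin
  (e ∸ suc t) + (a ∸ suc t) ≤⟨ ∸-superadditive e a (suc t) ⟩
  (e + a) ∸ suc t           ≡⟨ cong (_∸ suc t) (+-comm e a) ⟩
  (a + e) ∸ suc t           ≡⟨ +-identityʳ _ ⟨
  ((a + e) ∸ suc t) + 0     ∎
  where open ≤-Reasoning
∸-exchange (suc c) (suc a) e (suc t) (s≤s c≤a) = ∸-exchange c a e t c≤a

-- m exchanges, each moving one e from the last value onto some a j.
∑∸-spread : ∀ m (a : ℕ → ℕ) b e t → (∀ j → j < m → b + j * e ≤ a j) →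
  ∑[ j < m ] (a j ∸ t) + ((b + m * e) ∸ t) ≤ ∑[ j < m ] ((a j + e) ∸ t) + (b ∸ t)
∑∸-spread zero    a b e t _ = ≤-reflexive (cong (λ x → x ∸ t) (+-identityʳ b))
∑∸-spread (suc m) a b e t b+je≤a = begin
  (S + (a m ∸ t)) + ((b + suc m * e) ∸ t) ≡⟨ cong (λ x → (S + (a m ∸ t)) + (x ∸ t)) b+[1+m]e≡c+e ⟩
  (S + (a m ∸ t)) + ((c + e) ∸ t)         ≡⟨ +-assoc S _ _ ⟩
  S + ((a m ∸ t) + ((c + e) ∸ t))         ≡⟨ cong (S +_) (+-comm (a m ∸ t) _) ⟩
  S + (((c + e) ∸ t) + (a m ∸ t))         ≤⟨ +-monoʳ-≤ S (∸-exchange c (a m) e t (b+je≤a m ≤-refl)) ⟩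
  S + (((a m + e) ∸ t) + (c ∸ t))         ≡⟨ +-CS.x∙yz≈xz∙y S _ _ ⟩
  (S + (c ∸ t)) + ((a m + e) ∸ t)         ≤⟨ +-monoˡ-≤ _ (∑∸-spread m a b e t (λ j j<m → b+je≤a j (m<n⇒m<1+n j<m))) ⟩
  (S′ + (b ∸ t)) + ((a m + e) ∸ t)        ≡⟨ +-CS.xy∙z≈xz∙y S′ _ _ ⟩
  (S′ + ((a m + e) ∸ t)) + (b ∸ t)        ∎
  where
  open ≤-Reasoning
  S S′ c : ℕ
  S  = ∑[ j < m ] (a j ∸ t)
  S′ = ∑[ j < m ] ((a j + e) ∸ t)
  c  = b + m * e
  b+[1+m]e≡c+e : b + suc m * e ≡ c + e
  b+[1+m]e≡c+e = trans (cong (b +_) (+-comm e (m * e))) (sym (+-assoc b (m * e) e))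

suffix : ℕ → (ℕ → ℕ) → ℕ → ℕ
suffix ℓ z j = ∑[ q < ℓ ] (⟦ j < q ⟧ * z q)

suffix-step : ∀ n z j → j < n → suffix (suc n) z j ≡ suffix n z j + z n
suffix-step n z j j<n = cong (suffix n z j +_) (trans (cong (_* z n) (⟦<⟧-< j<n)) (*-identityˡ (z n)))

suffix-last : ∀ n z → suffix (suc n) z n ≡ 0
suffix-last n z = ∑-zero (suc n) (λ q q<1+n → cong (_* z q) (⟦<⟧-≥ {n} {q} (s≤s⁻¹ q<1+n)))

-- The last value u n + n z n hands z n to each earlier value (∑∸-spread); then induct.
∑∸-rearrangement : ∀ n (u z : ℕ → ℕ) → u Preserves _≤_ ⟶ _≥_ → z Preserves _≤_ ⟶ _≥_ → ∀ t →
  ∑[ j < n ] ((u j + j * z j) ∸ t) ≤ ∑[ j < n ] ((u j + suffix n z j) ∸ t)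
∑∸-rearrangement zero    u z _ _ t = z≤n
∑∸-rearrangement (suc n) u z u↓ z↓ t = begin
  ∑[ j < n ] ((u j + j * z j) ∸ t) + ((u n + n * z n) ∸ t)
    ≤⟨ ∑∸-spread n (λ j → u j + j * z j) (u n) (z n) t
         (λ j j<n → +-mono-≤ (u↓ (<⇒≤ j<n)) (*-monoʳ-≤ j (z↓ (<⇒≤ j<n)))) ⟩
  ∑[ j < n ] (((u j + j * z j) + z n) ∸ t) + (u n ∸ t)
    ≡⟨ cong (_+ (u n ∸ t)) (∑-cong n (λ j _ → cong (_∸ t) (+-CS.xy∙z≈xz∙y (u j) (j * z j) (z n)))) ⟩
  ∑[ j < n ] (((u j + z n) + j * z j) ∸ t) + (u n ∸ t)
    ≤⟨ +-monoˡ-≤ (u n ∸ t) (∑∸-rearrangement n (λ j → u j + z n) z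
         (λ a≤b → +-monoˡ-≤ (z n) (u↓ a≤b)) z↓ t) ⟩
  ∑[ j < n ] (((u j + z n) + suffix n z j) ∸ t) + (u n ∸ t)
    ≡⟨ cong₂ _+_ (∑-cong n (λ j j<n → cong (_∸ t) (extend j j<n))) (cong (_∸ t) last) ⟩
  ∑[ j < n ] ((u j + suffix (suc n) z j) ∸ t) + ((u n + suffix (suc n) z n) ∸ t) ∎
  where
  open ≤-Reasoning
  extend : ∀ j → j < n → (u j + z n) + suffix n z j ≡ u j + suffix (suc n) z j
  extend j j<n = trans (+-CS.xy∙z≈x∙zy (u j) (z n) _) (cong (u j +_) (sym (suffix-step n z j j<n)))
  last : u n ≡ u n + suffix (suc n) z n
  last = sym (trans (cong (u n +_) (suffix-last n z)) (+-identityʳ (u n)))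

IsInitialSegment : ℕ → (ℕ → ℕ) → Set
IsInitialSegment n f = ∃[ ℓ ] ℓ ≤ n × (∀ c → f c ≡ ⟦ c < ℓ ⟧)

initialSegment : ∀ n (f : ℕ → ℕ) → (∀ c → f c ≤ 1) → f Preserves _≤_ ⟶ _≥_ →
  (∀ c → n ≤ c → f c ≡ 0) → IsInitialSegment n f
initialSegment zero    f f≤1 f↓ f₀ = 0 , z≤n , λ c → f₀ c z≤n
initialSegment (suc n) f f≤1 f↓ f₀ with f n in fn≡ | f≤1 n
... | zero | _
  with ℓ , ℓ≤n , f≡ ← initialSegment n f f≤1 f↓ (λ c n≤c → n≤0⇒n≡0 (subst (f c ≤_) fn≡ (f↓ n≤c)))
  = ℓ , m≤n⇒m≤1+n ℓ≤n , f≡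
... | suc (suc _) | s≤s ()
... | suc zero | _ = suc n , ≤-refl , f≡
  where
  f≡ : ∀ c → f c ≡ ⟦ c < suc n ⟧
  f≡ c with c <? suc n
  ... | yes c<1+n = trans (≤-antisym (f≤1 c) (subst (_≤ f c) fn≡ (f↓ (s≤s⁻¹ c<1+n)))) (sym (⟦<⟧-< c<1+n))
  ... | no  c≮1+n = trans (f₀ c (≮⇒≥ c≮1+n)) (sym (⟦<⟧-≥ {c} (≮⇒≥ c≮1+n)))

∑∸-rearrangement-on : ∀ n (f u z : ℕ → ℕ) t → IsInitialSegment n f →
  u Preserves _≤_ ⟶ _≥_ → z Preserves _≤_ ⟶ _≥_ →
  ∑[ c < n ] (f c * ((u c + c * z c) ∸ t)) ≤ ∑[ c < n ] (f c * ((u c + suffix n (λ q → f q * z q) c) ∸ t))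
∑∸-rearrangement-on n f u z t (ℓ , ℓ≤n , f≡) u↓ z↓ = begin
  ∑[ c < n ] (f c * ((u c + c * z c) ∸ t))
    ≡⟨ on-segment _ ⟩
  ∑[ c < ℓ ] ((u c + c * z c) ∸ t)
    ≤⟨ ∑∸-rearrangement ℓ u z u↓ z↓ t ⟩
  ∑[ c < ℓ ] ((u c + suffix ℓ z c) ∸ t)
    ≡⟨ on-segment _ ⟨
  ∑[ c < n ] (f c * ((u c + suffix ℓ z c) ∸ t))
    ≡⟨ ∑-cong n (λ c _ → cong (λ s → f c * ((u c + s) ∸ t)) (suffix-on c)) ⟩
  ∑[ c < n ] (f c * ((u c + suffix n (λ q → f q * z q) c) ∸ t)) ∎
  where
  open ≤-Reasoning
  on-segment : ∀ g → ∑[ c < n ] (f c * g c) ≡ ∑ ℓ g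
  on-segment g = trans (∑-cong n (λ c _ → cong (_* g c) (f≡ c))) (∑-prefix n ℓ g ℓ≤n)
  suffix-on : ∀ c → suffix ℓ z c ≡ suffix n (λ q → f q * z q) c
  suffix-on c = trans (sym (on-segment _)) (∑-cong n (λ q _ → *-CS.x∙yz≈y∙xz (f q) ⟦ c < q ⟧ (z q)))

suffix-const : ∀ n (f : ℕ → ℕ) d c → suffix n (λ q → f q * d) c ≡ d * suffix n (λ q → f q * 1) c
suffix-const n f d c = trans (∑-cong n (λ q _ → commute ⟦ c < q ⟧ (f q) d)) (∑-*ˡ n d _)
  where
  commute : ∀ x y d → x * (y * d) ≡ d * (x * (y * 1))
  commute = solve-∀

suffix-distrib-+ : ∀ n (f g h : ℕ → ℕ) c →
  suffix n (λ q → f q * (g q + h q)) c ≡ suffix n (λ q → f q * g q) c + suffix n (λ q → f q * h q) c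
suffix-distrib-+ n f g h c = trans (∑-cong n (λ q _ → distrib ⟦ c < q ⟧ (f q) (g q) (h q))) (∑-distrib-+ n _ _)
  where
  distrib : ∀ x y u v → x * (y * (u + v)) ≡ x * (y * u) + x * (y * v)
  distrib x y u v = trans (cong (x *_) (*-distribˡ-+ y u v)) (*-distribˡ-+ x (y * u) (y * v))

suffix-affine : ∀ n (f : ℕ → ℕ) d (w : ℕ → ℕ) c →
  suffix n (λ q → f q * (d + w q)) c ≡ d * suffix n (λ q → f q * 1) c + suffix n (λ q → f q * w q) c
suffix-affine n f d w c = trans (suffix-distrib-+ n f (λ _ → d) w c) (cong (_+ suffix n (λ q → f q * w q) c) (suffix-const n f d c))

m≤n≤1⇒n*m≡m : ∀ {m n} → m ≤ n → n ≤ 1 → n * m ≡ m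
m≤n≤1⇒n*m≡m {n = zero}  z≤n _ = refl
m≤n≤1⇒n*m≡m {n = suc zero} _ _ = +-identityʳ _
m≤n≤1⇒n*m≡m {n = suc (suc _)} _ (s≤s ())

-- Both sides count the cells (a, b) with a > x and b > y; the factor G x b is redundant on the
-- left since G is antitone in a.
∑-suffix-plane : ∀ n x y (G : ℕ → ℕ → ℕ) → (∀ {a} b → x < a → G a b ≤ G x b) → (∀ b → G x b ≤ 1) →
  ∑[ b < n ] (⟦ y < b ⟧ * (G x b * suffix n (λ a → G a b * 1) x))
  ≡ ∑[ a < n ] (⟦ x < a ⟧ * ∑[ b < n ] (⟦ y < b ⟧ * G a b))
∑-suffix-plane n x y G G↓ G≤1 = begin
  ∑[ b < n ] (⟦ y < b ⟧ * (G x b * suffix n (λ a → G a b * 1) x))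
    ≡⟨ ∑-cong n (λ b _ → trans (cong (⟦ y < b ⟧ *_) (sym (∑-*ˡ n (G x b) _))) (sym (∑-*ˡ n ⟦ y < b ⟧ _))) ⟩
  ∑[ b < n ] ∑[ a < n ] (⟦ y < b ⟧ * (G x b * (⟦ x < a ⟧ * (G a b * 1))))
    ≡⟨ ∑-cong n (λ b _ → ∑-cong n (λ a _ → absorb a b)) ⟩
  ∑[ b < n ] ∑[ a < n ] (⟦ x < a ⟧ * (⟦ y < b ⟧ * G a b))
    ≡⟨ ∑-comm n n _ ⟩
  ∑[ a < n ] ∑[ b < n ] (⟦ x < a ⟧ * (⟦ y < b ⟧ * G a b))
    ≡⟨ ∑-cong n (λ a _ → ∑-*ˡ n ⟦ x < a ⟧ _) ⟩
  ∑[ a < n ] (⟦ x < a ⟧ * ∑[ b < n ] (⟦ y < b ⟧ * G a b)) ∎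
  where
  open ≡-Reasoning
  absorb : ∀ a b → ⟦ y < b ⟧ * (G x b * (⟦ x < a ⟧ * (G a b * 1))) ≡ ⟦ x < a ⟧ * (⟦ y < b ⟧ * G a b)
  absorb a b with x <? a
  ... | yes x<a rewrite ⟦<⟧-< x<a | *-identityʳ (G a b) | +-identityʳ (G a b)
                      | m≤n≤1⇒n*m≡m (G↓ b x<a) (G≤1 b) = sym (+-identityʳ _)
  ... | no  x≮a rewrite ⟦<⟧-≥ {x} (≮⇒≥ x≮a) | *-zeroʳ (G x b) | *-zeroʳ ⟦ y < b ⟧ = refl

-- Hooks as disjoint unions of boxes

data Position : Set where
  below at above : Position

position : ℕ → ℕ → Position
position zero    zero    = at
position zero    (suc b) = below
position (suc a) zero    = above
position (suc a) (suc b) = position a b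

isBelow isAt isAbove : Position → Bool
isBelow below = true
isBelow _     = false
isAt at = true
isAt _  = false
isAbove above = true
isAbove _     = false

≡ᵇ-position : ∀ a b → (a ≡ᵇ b) ≡ isAt (position a b)
≡ᵇ-position zero    zero    = refl
≡ᵇ-position zero    (suc b) = refl
≡ᵇ-position (suc a) zero    = refl
≡ᵇ-position (suc a) (suc b) = ≡ᵇ-position a b

<ᵇ-position : ∀ a b → (a <ᵇ b) ≡ isBelow (position a b)
<ᵇ-position zero    zero    = refl
<ᵇ-position zero    (suc b) = refl
<ᵇ-position (suc a) zero    = refl
<ᵇ-position (suc a) (suc b) = <ᵇ-position a b

>ᵇ-position : ∀ a b → (b <ᵇ a) ≡ isAbove (position a b)
>ᵇ-position zero    zero    = refl
>ᵇ-position zero    (suc b) = refl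
>ᵇ-position (suc a) zero    = refl
>ᵇ-position (suc a) (suc b) = >ᵇ-position a b

<ᵇ-suc : ∀ a b → (a <ᵇ suc b) ≡ (a ≤ᵇ b)
<ᵇ-suc zero    b = refl
<ᵇ-suc (suc a) b = refl

≤ᵇ-position : ∀ a b → (a ≤ᵇ b) ≡ not (isAbove (position a b))
≤ᵇ-position zero    zero    = refl
≤ᵇ-position zero    (suc b) = refl
≤ᵇ-position (suc a) zero    = refl
≤ᵇ-position (suc a) (suc b) = trans (<ᵇ-suc a b) (≤ᵇ-position a b)

≥ᵇ-position : ∀ a b → (b ≤ᵇ a) ≡ not (isBelow (position a b))
≥ᵇ-position zero    zero    = refl
≥ᵇ-position zero    (suc b) = refl
≥ᵇ-position (suc a) zero    = refl
≥ᵇ-position (suc a) (suc b) = trans (<ᵇ-suc b a) (≥ᵇ-position a b)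

every : (Position → Bool) → Bool
every f = f below ∧ f at ∧ f above

every-sound : ∀ f → T (every f) → ∀ o → T (f o)
every-sound f t below = proj₁ (Equivalence.to (T-∧ {f below}) t)
every-sound f t at    = proj₁ (Equivalence.to (T-∧ {f at}) (proj₂ (Equivalence.to (T-∧ {f below}) t)))
every-sound f t above = proj₂ (Equivalence.to (T-∧ {f at}) (proj₂ (Equivalence.to (T-∧ {f below}) t)))

by-evaluation : ∀ {f g : Position → Position → Position → ℕ} →
  T (every λ o₁ → every λ o₂ → every λ o₃ → f o₁ o₂ o₃ ≡ᵇ g o₁ o₂ o₃) →
  ∀ o₁ o₂ o₃ → f o₁ o₂ o₃ ≡ g o₁ o₂ o₃
by-evaluation {f} {g} t o₁ o₂ o₃ = ≡ᵇ⇒≡ (f o₁ o₂ o₃) (g o₁ o₂ o₃)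
  (every-sound (λ o₃ → f o₁ o₂ o₃ ≡ᵇ g o₁ o₂ o₃)
    (every-sound (λ o₂ → every λ o₃ → f o₁ o₂ o₃ ≡ᵇ g o₁ o₂ o₃)
      (every-sound (λ o₁ → every λ o₂ → every λ o₃ → f o₁ o₂ o₃ ≡ᵇ g o₁ o₂ o₃) t o₁) o₂) o₃)

Separable : Set
Separable = (ℕ → ℕ) × (ℕ → ℕ) × (ℕ → ℕ)

⟪_⟫ : Separable → ℕ → ℕ → ℕ → ℕ
⟪ A , B , C ⟫ p q r = A p * (B q * C r)

expand : List Separable → ℕ → ℕ → ℕ → ℕ
expand Ts p q r = sum (map (λ T → ⟪ T ⟫ p q r) Ts)

R-pieces R*-pieces Q-pieces Q*-pieces : Cell → List Separable
R-pieces (i , j , k) =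
  (⟦_≐ i ⟧ , ⟦_≐ j ⟧ , ⟦_≐ k ⟧) ∷ (⟦ i <_⟧ , ⟦_≐ j ⟧ , ⟦_≐ k ⟧) ∷
  (⟦_≐ i ⟧ , ⟦ j <_⟧ , ⟦_≐ k ⟧) ∷ (⟦_≐ i ⟧ , ⟦_≐ j ⟧ , ⟦ k <_⟧) ∷ []
R*-pieces (i , j , k) =
  (⟦_≐ i ⟧ , ⟦_≐ j ⟧ , ⟦_≐ k ⟧) ∷ (⟦_< i ⟧ , ⟦_≐ j ⟧ , ⟦_≐ k ⟧) ∷
  (⟦_≐ i ⟧ , ⟦_< j ⟧ , ⟦_≐ k ⟧) ∷ (⟦_≐ i ⟧ , ⟦_≐ j ⟧ , ⟦_< k ⟧) ∷ []
Q-pieces (i , j , k) =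
  (⟦_≐ i ⟧ , ⟦_≐ j ⟧ , ⟦_≐ k ⟧) ∷ (⟦ i <_⟧ , ⟦_≐ j ⟧ , ⟦_≐ k ⟧) ∷ (⟦_≐ i ⟧ , ⟦ j <_⟧ , ⟦_≐ k ⟧) ∷
  (⟦ i <_⟧ , ⟦ j <_⟧ , ⟦_≐ k ⟧) ∷ (⟦_≐ i ⟧ , ⟦_≐ j ⟧ , ⟦ k <_⟧) ∷ (⟦ i <_⟧ , ⟦_≐ j ⟧ , ⟦ k <_⟧) ∷
  (⟦_≐ i ⟧ , ⟦ j <_⟧ , ⟦ k <_⟧) ∷ []
Q*-pieces (i , j , k) =
  (⟦_≤ i ⟧ , ⟦_≤ j ⟧ , ⟦_≐ k ⟧) ∷ (⟦_≐ i ⟧ , ⟦_≤ j ⟧ , ⟦_< k ⟧) ∷ (⟦_< i ⟧ , ⟦_≐ j ⟧ , ⟦_< k ⟧) ∷ []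

-- Every test in a hook depends on a coordinate only through its position relative to the corner,
-- so the decompositions can be checked on the 27 relative positions.
private
  at? below? above? atOrBelow? : Position → ℕ
  at?        o = 𝟙 (isAt o)
  below?     o = 𝟙 (isBelow o)
  above?     o = 𝟙 (isAbove o)
  atOrBelow? o = 𝟙 (not (isAbove o))

  R-table : ∀ o₁ o₂ o₃ →
    𝟙 (isAt o₂ ∧ isAt o₃ ∧ not (isBelow o₁) ∨ isAt o₁ ∧ isAt o₃ ∧ not (isBelow o₂) ∨ isAt o₁ ∧ isAt o₂ ∧ not (isBelow o₃))
    ≡ sum (at? o₁ * (at? o₂ * at? o₃) ∷ above? o₁ * (at? o₂ * at? o₃) ∷
           at? o₁ * (above? o₂ * at? o₃) ∷ at? o₁ * (at? o₂ * above? o₃) ∷ [])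
  R-table = by-evaluation _

  R*-table : ∀ o₁ o₂ o₃ →
    𝟙 (isAt o₂ ∧ isAt o₃ ∧ not (isAbove o₁) ∨ isAt o₁ ∧ isAt o₃ ∧ not (isAbove o₂) ∨ isAt o₁ ∧ isAt o₂ ∧ not (isAbove o₃))
    ≡ sum (at? o₁ * (at? o₂ * at? o₃) ∷ below? o₁ * (at? o₂ * at? o₃) ∷
           at? o₁ * (below? o₂ * at? o₃) ∷ at? o₁ * (at? o₂ * below? o₃) ∷ [])
  R*-table = by-evaluation _

  Q-table : ∀ o₁ o₂ o₃ →
    𝟙 (isAt o₃ ∧ not (isBelow o₁) ∧ not (isBelow o₂) ∨ isAt o₂ ∧ not (isBelow o₁) ∧ not (isBelow o₃)
       ∨ isAt o₁ ∧ not (isBelow o₂) ∧ not (isBelow o₃))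
    ≡ sum (at? o₁ * (at? o₂ * at? o₃) ∷ above? o₁ * (at? o₂ * at? o₃) ∷ at? o₁ * (above? o₂ * at? o₃) ∷
           above? o₁ * (above? o₂ * at? o₃) ∷ at? o₁ * (at? o₂ * above? o₃) ∷ above? o₁ * (at? o₂ * above? o₃) ∷
           at? o₁ * (above? o₂ * above? o₃) ∷ [])
  Q-table = by-evaluation _

  Q*-table : ∀ o₁ o₂ o₃ →
    𝟙 (isAt o₃ ∧ not (isAbove o₁) ∧ not (isAbove o₂) ∨ isAt o₂ ∧ not (isAbove o₁) ∧ not (isAbove o₃)
       ∨ isAt o₁ ∧ not (isAbove o₂) ∧ not (isAbove o₃))
    ≡ sum (atOrBelow? o₁ * (atOrBelow? o₂ * at? o₃) ∷ at? o₁ * (atOrBelow? o₂ * below? o₃) ∷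
           below? o₁ * (at? o₂ * below? o₃) ∷ [])
  Q*-table = by-evaluation _

𝟙-RHook : ∀ x p q r → 𝟙 (does (RHook? x (p , q , r))) ≡ expand (R-pieces x) p q r
𝟙-RHook (i , j , k) p q r
  rewrite ≡ᵇ-position p i | ≡ᵇ-position q j | ≡ᵇ-position r k
        | ≥ᵇ-position p i | ≥ᵇ-position q j | ≥ᵇ-position r k
        | >ᵇ-position p i | >ᵇ-position q j | >ᵇ-position r k
  = R-table (position p i) (position q j) (position r k)

𝟙-R*Hook : ∀ x p q r → 𝟙 (does (R*Hook? x (p , q , r))) ≡ expand (R*-pieces x) p q r
𝟙-R*Hook (i , j , k) p q r
  rewrite ≡ᵇ-position p i | ≡ᵇ-position q j | ≡ᵇ-position r k
        | ≤ᵇ-position p i | ≤ᵇ-position q j | ≤ᵇ-position r k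
        | <ᵇ-position p i | <ᵇ-position q j | <ᵇ-position r k
  = R*-table (position p i) (position q j) (position r k)

𝟙-QHook : ∀ x p q r → 𝟙 (does (QHook? x (p , q , r))) ≡ expand (Q-pieces x) p q r
𝟙-QHook (i , j , k) p q r
  rewrite ≡ᵇ-position p i | ≡ᵇ-position q j | ≡ᵇ-position r k
        | ≥ᵇ-position p i | ≥ᵇ-position q j | ≥ᵇ-position r k
        | >ᵇ-position p i | >ᵇ-position q j | >ᵇ-position r k
  = Q-table (position p i) (position q j) (position r k)

𝟙-Q*Hook : ∀ x p q r → 𝟙 (does (Q*Hook? x (p , q , r))) ≡ expand (Q*-pieces x) p q r
𝟙-Q*Hook (i , j , k) p q r
  rewrite ≡ᵇ-position p i | ≡ᵇ-position q j | ≡ᵇ-position r k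
        | ≤ᵇ-position p i | ≤ᵇ-position q j | ≤ᵇ-position r k
        | <ᵇ-position p i | <ᵇ-position r k
  = Q*-table (position p i) (position q j) (position r k)

-- Downsets in a cube

coordinates< : ∀ i j k {n} → i + j + k < n → i < n × j < n × k < n
coordinates< i j k i+j+k<n =
  ≤-<-trans (≤-trans (m≤m+n i j) (m≤m+n (i + j) k)) i+j+k<n ,
  ≤-<-trans (≤-trans (m≤n+m j i) (m≤m+n (i + j) k)) i+j+k<n ,
  ≤-<-trans (m≤n+m k (i + j)) i+j+k<n

Antitone³ : (ℕ → ℕ → ℕ → ℕ) → Set
Antitone³ F = ∀ {p q r p′ q′ r′} → p ≤ p′ → q ≤ q′ → r ≤ r′ → F p′ q′ r′ ≤ F p q r

module Cube (N : ℕ) where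

  ∑³ : (ℕ → ℕ → ℕ → ℕ) → ℕ
  ∑³ F = ∑[ p < N ] ∑[ q < N ] ∑[ r < N ] F p q r

  ∑³-cong : ∀ {F G} → (∀ p q r → F p q r ≡ G p q r) → ∑³ F ≡ ∑³ G
  ∑³-cong F≡G = ∑-cong N λ p _ → ∑-cong N λ q _ → ∑-cong N λ r _ → F≡G p q r

  ∑³-distrib-+ : ∀ F G → ∑³ (λ p q r → F p q r + G p q r) ≡ ∑³ F + ∑³ G
  ∑³-distrib-+ F G = trans (∑-cong N (λ p _ → trans (∑-cong N (λ q _ → ∑-distrib-+ N (F p q) (G p q))) (∑-distrib-+ N _ _)))
                           (∑-distrib-+ N _ _)

  ∑³-by-lines₁ : ∀ F → ∑³ F ≡ ∑[ q < N ] ∑[ r < N ] ∑[ p < N ] F p q r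
  ∑³-by-lines₁ F = trans (∑-comm N N (λ p q → ∑[ r < N ] F p q r)) (∑-cong N λ q _ → ∑-comm N N (λ p r → F p q r))

  ∑³-by-lines₂ : ∀ F → ∑³ F ≡ ∑[ p < N ] ∑[ r < N ] ∑[ q < N ] F p q r
  ∑³-by-lines₂ F = ∑-cong N λ p _ → ∑-comm N N (λ q r → F p q r)

  ∑³-separable : ∀ (A B C : ℕ → ℕ) (G : ℕ → ℕ → ℕ → ℕ) →
    ∑³ (λ p q r → A p * (B q * (C r * G p q r))) ≡ ∑[ p < N ] (A p * ∑[ q < N ] (B q * ∑[ r < N ] (C r * G p q r)))
  ∑³-separable A B C G = ∑-cong N λ p _ →
    trans (∑-cong N (λ q _ → trans (∑-*ˡ N (A p) _) (cong (A p *_) (∑-*ˡ N (B q) _)))) (∑-*ˡ N (A p) _)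

  ∑³-point : ∀ {a b c} (G : ℕ → ℕ → ℕ → ℕ) → a < N → b < N → c < N →
    ∑³ (λ p q r → ⟦ p ≐ a ⟧ * (⟦ q ≐ b ⟧ * (⟦ r ≐ c ⟧ * G p q r))) ≡ G a b c
  ∑³-point {a} {b} {c} G a<N b<N c<N = trans (∑³-separable ⟦_≐ a ⟧ ⟦_≐ b ⟧ ⟦_≐ c ⟧ G)
    (trans (∑-point N a _ a<N) (trans (∑-point N b _ b<N) (∑-point N c _ c<N)))

module Downset (N : ℕ) (χ : ℕ → ℕ → ℕ → ℕ) (χ≤1 : ∀ p q r → χ p q r ≤ 1) (χ-antitone : Antitone³ χ)
  (χ-bounded : ∀ {p q r} → N ≤ p + q + r → χ p q r ≡ 0) where

  open Cube N

  mass : (ℕ → ℕ → ℕ → ℕ) → ℕ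
  mass F = ∑³ (λ p q r → χ p q r * F p q r)

  mass-cong : ∀ {F G} → (∀ p q r → F p q r ≡ G p q r) → mass F ≡ mass G
  mass-cong F≡G = ∑³-cong λ p q r → cong (χ p q r *_) (F≡G p q r)

  excess³ : ℕ → (ℕ → ℕ → ℕ → ℕ) → ℕ
  excess³ t G = mass (λ p q r → G p q r ∸ t)

  up₁ up₂ up₃ : (ℕ → ℕ → ℕ → ℕ) → ℕ → ℕ → ℕ → ℕ
  up₁ z p q r = suffix N (λ c → χ c q r * z c q r) p
  up₂ z p q r = suffix N (λ c → χ p c r * z p c r) q
  up₃ z p q r = suffix N (λ c → χ p q c * z p q c) r

  excess³-cong : ∀ t {G H} → (∀ p q r → G p q r ≡ H p q r) → excess³ t G ≡ excess³ t H
  excess³-cong t G≡H = mass-cong λ p q r → cong (_∸ t) (G≡H p q r)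

  up₁-antitone : ∀ {z} → Antitone³ z → Antitone³ (up₁ z)
  up₁-antitone z↓ p≤p′ q≤q′ r≤r′ = ∑-mono-≤ N λ c _ →
    *-mono-≤ (⟦<⟧-antitoneˡ c p≤p′) (*-mono-≤ (χ-antitone ≤-refl q≤q′ r≤r′) (z↓ ≤-refl q≤q′ r≤r′))

  up₂-antitone : ∀ {z} → Antitone³ z → Antitone³ (up₂ z)
  up₂-antitone z↓ p≤p′ q≤q′ r≤r′ = ∑-mono-≤ N λ c _ →
    *-mono-≤ (⟦<⟧-antitoneˡ c q≤q′) (*-mono-≤ (χ-antitone p≤p′ ≤-refl r≤r′) (z↓ p≤p′ ≤-refl r≤r′))

  private
    line₁ : ∀ q r → IsInitialSegment N (λ c → χ c q r)
    line₁ q r = initialSegment N _ (λ c → χ≤1 c q r) (λ a≤b → χ-antitone a≤b ≤-refl ≤-refl)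
      (λ c N≤c → χ-bounded (≤-trans N≤c (≤-trans (m≤m+n c q) (m≤m+n (c + q) r))))

    line₂ : ∀ p r → IsInitialSegment N (λ c → χ p c r)
    line₂ p r = initialSegment N _ (λ c → χ≤1 p c r) (λ a≤b → χ-antitone ≤-refl a≤b ≤-refl)
      (λ c N≤c → χ-bounded (≤-trans N≤c (≤-trans (m≤n+m c p) (m≤m+n (p + c) r))))

    line₃ : ∀ p q → IsInitialSegment N (λ c → χ p q c)
    line₃ p q = initialSegment N _ (λ c → χ≤1 p q c) (λ a≤b → χ-antitone ≤-refl ≤-refl a≤b)
      (λ c N≤c → χ-bounded (≤-trans N≤c (m≤n+m c (p + q))))

  step₁ : ∀ (u z : ℕ → ℕ → ℕ → ℕ) →
    (∀ {q r} → (λ p → u p q r) Preserves _≤_ ⟶ _≥_) → (∀ {q r} → (λ p → z p q r) Preserves _≤_ ⟶ _≥_) →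
    ∀ t → excess³ t (λ p q r → u p q r + p * z p q r) ≤ excess³ t (λ p q r → u p q r + up₁ z p q r)
  step₁ u z u↓ z↓ t = begin
    excess³ t _ ≡⟨ ∑³-by-lines₁ _ ⟩
    _           ≤⟨ ∑-mono-≤ N (λ q _ → ∑-mono-≤ N λ r _ →
                     ∑∸-rearrangement-on N _ (λ p → u p q r) (λ p → z p q r) t (line₁ q r) u↓ z↓) ⟩
    _           ≡⟨ ∑³-by-lines₁ _ ⟨
    excess³ t _ ∎
    where open ≤-Reasoning

  step₂ : ∀ (u z : ℕ → ℕ → ℕ → ℕ) →
    (∀ {p r} → (λ q → u p q r) Preserves _≤_ ⟶ _≥_) → (∀ {p r} → (λ q → z p q r) Preserves _≤_ ⟶ _≥_) →
    ∀ t → excess³ t (λ p q r → u p q r + q * z p q r) ≤ excess³ t (λ p q r → u p q r + up₂ z p q r)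
  step₂ u z u↓ z↓ t = begin
    excess³ t _ ≡⟨ ∑³-by-lines₂ _ ⟩
    _           ≤⟨ ∑-mono-≤ N (λ p _ → ∑-mono-≤ N λ r _ →
                     ∑∸-rearrangement-on N _ (λ q → u p q r) (λ q → z p q r) t (line₂ p r) u↓ z↓) ⟩
    _           ≡⟨ ∑³-by-lines₂ _ ⟨
    excess³ t _ ∎
    where open ≤-Reasoning

  step₃ : ∀ (u z : ℕ → ℕ → ℕ → ℕ) →
    (∀ {p q} → (λ r → u p q r) Preserves _≤_ ⟶ _≥_) → (∀ {p q} → (λ r → z p q r) Preserves _≤_ ⟶ _≥_) →
    ∀ t → excess³ t (λ p q r → u p q r + r * z p q r) ≤ excess³ t (λ p q r → u p q r + up₃ z p q r)
  step₃ u z u↓ z↓ t = ∑-mono-≤ N λ p _ → ∑-mono-≤ N λ q _ →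
    ∑∸-rearrangement-on N _ (λ r → u p q r) (λ r → z p q r) t (line₃ p q) u↓ z↓

  one : ℕ → ℕ → ℕ → ℕ
  one _ _ _ = 1

  arm₁ arm₂ arm₃ : ℕ → ℕ → ℕ → ℕ
  arm₁ = up₁ one
  arm₂ = up₂ one
  arm₃ = up₃ one

  arm₁-antitone : Antitone³ arm₁
  arm₁-antitone = up₁-antitone λ _ _ _ → ≤-refl

  arm₂-antitone : Antitone³ arm₂
  arm₂-antitone = up₂-antitone λ _ _ _ → ≤-refl

  R*-value R-value : ℕ → ℕ → ℕ → ℕ
  R*-value p q r = suc (p + q + r)
  R-value  p q r = suc (arm₁ p q r + arm₂ p q r + arm₃ p q r)

  excess-R*≤R : ∀ t → excess³ t R*-value ≤ excess³ t R-value
  excess-R*≤R t = begin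
    excess³ t R*-value
      ≡⟨ excess³-cong t isolate₁ ⟩
    excess³ t (λ p q r → (1 + q + r) + p * 1)
      ≤⟨ step₁ (λ p q r → 1 + q + r) one (λ _ → ≤-refl) (λ _ → ≤-refl) t ⟩
    excess³ t (λ p q r → (1 + q + r) + arm₁ p q r)
      ≡⟨ excess³-cong t (λ p q r → isolate₂ (arm₁ p q r) q r) ⟩
    excess³ t (λ p q r → (1 + arm₁ p q r + r) + q * 1)
      ≤⟨ step₂ (λ p q r → 1 + arm₁ p q r + r) one
           (λ q≤q′ → +-monoˡ-≤ _ (s≤s (arm₁-antitone ≤-refl q≤q′ ≤-refl))) (λ _ → ≤-refl) t ⟩
    excess³ t (λ p q r → (1 + arm₁ p q r + r) + arm₂ p q r)
      ≡⟨ excess³-cong t (λ p q r → isolate₃ (arm₁ p q r) (arm₂ p q r) r) ⟩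
    excess³ t (λ p q r → (1 + arm₁ p q r + arm₂ p q r) + r * 1)
      ≤⟨ step₃ (λ p q r → 1 + arm₁ p q r + arm₂ p q r) one
           (λ r≤r′ → s≤s (+-mono-≤ (arm₁-antitone ≤-refl ≤-refl r≤r′) (arm₂-antitone ≤-refl ≤-refl r≤r′)))
           (λ _ → ≤-refl) t ⟩
    excess³ t (λ p q r → (1 + arm₁ p q r + arm₂ p q r) + arm₃ p q r)
      ≡⟨ excess³-cong t (λ p q r → collect (arm₁ p q r) (arm₂ p q r) (arm₃ p q r)) ⟩
    excess³ t R-value ∎
    where
    open ≤-Reasoning
    isolate₁ : ∀ p q r → suc (p + q + r) ≡ (1 + q + r) + p * 1
    isolate₁ = solve-∀
    isolate₂ : ∀ a q r → (1 + q + r) + a ≡ (1 + a + r) + q * 1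
    isolate₂ = solve-∀
    isolate₃ : ∀ a b r → (1 + a + r) + b ≡ (1 + a + b) + r * 1
    isolate₃ = solve-∀
    collect : ∀ a b c → (1 + a + b) + c ≡ suc (a + b + c)
    collect = solve-∀

  Q*-value Q-value : ℕ → ℕ → ℕ → ℕ
  Q*-value p q r = 1 + p + q + r + p * q + p * r + q * r
  Q-value  p q r = (1 + arm₁ p q r + arm₂ p q r + up₂ arm₁ p q r) + up₃ (λ p q r → 1 + arm₁ p q r + arm₂ p q r) p q r

  excess-Q*≤Q : ∀ t → excess³ t Q*-value ≤ excess³ t Q-value
  excess-Q*≤Q t = begin
    excess³ t Q*-value
      ≡⟨ excess³-cong t isolate₁ ⟩
    excess³ t (λ p q r → (1 + q) * (1 + r) + p * (1 + q + r))
      ≤⟨ step₁ (λ p q r → (1 + q) * (1 + r)) (λ p q r → 1 + q + r) (λ _ → ≤-refl) (λ _ → ≤-refl) t ⟩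
    excess³ t (λ p q r → (1 + q) * (1 + r) + up₁ (λ p q r → 1 + q + r) p q r)
      ≡⟨ excess³-cong t isolate₂ ⟩
    excess³ t (λ p q r → (1 + r) * (1 + arm₁ p q r) + q * ((1 + r) + arm₁ p q r))
      ≤⟨ step₂ (λ p q r → (1 + r) * (1 + arm₁ p q r)) (λ p q r → (1 + r) + arm₁ p q r)
           (λ {_} {r} q≤q′ → *-monoʳ-≤ (1 + r) (s≤s (arm₁-antitone ≤-refl q≤q′ ≤-refl)))
           (λ {_} {r} q≤q′ → +-monoʳ-≤ (1 + r) (arm₁-antitone ≤-refl q≤q′ ≤-refl)) t ⟩
    excess³ t (λ p q r → (1 + r) * (1 + arm₁ p q r) + up₂ (λ p q r → (1 + r) + arm₁ p q r) p q r)
      ≡⟨ excess³-cong t isolate₃ ⟩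
    excess³ t (λ p q r → (1 + arm₁ p q r + arm₂ p q r + up₂ arm₁ p q r) + r * (1 + arm₁ p q r + arm₂ p q r))
      ≤⟨ step₃ (λ p q r → 1 + arm₁ p q r + arm₂ p q r + up₂ arm₁ p q r) (λ p q r → 1 + arm₁ p q r + arm₂ p q r)
           (λ r≤r′ → s≤s (+-mono-≤ (+-mono-≤ (arm₁-antitone ≤-refl ≤-refl r≤r′) (arm₂-antitone ≤-refl ≤-refl r≤r′))
                                    (up₂-antitone arm₁-antitone ≤-refl ≤-refl r≤r′)))
           (λ r≤r′ → s≤s (+-mono-≤ (arm₁-antitone ≤-refl ≤-refl r≤r′) (arm₂-antitone ≤-refl ≤-refl r≤r′))) t ⟩
    excess³ t Q-value ∎
    where
    open ≤-Reasoning
    isolate₁ : ∀ p q r → 1 + p + q + r + p * q + p * r + q * r ≡ (1 + q) * (1 + r) + p * (1 + q + r)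
    isolate₁ = solve-∀
    isolate₂ : ∀ p q r → (1 + q) * (1 + r) + up₁ (λ p q r → 1 + q + r) p q r
                       ≡ (1 + r) * (1 + arm₁ p q r) + q * ((1 + r) + arm₁ p q r)
    isolate₂ p q r = trans (cong ((1 + q) * (1 + r) +_) (suffix-const N (λ c → χ c q r) (1 + q + r) p)) (regroup (arm₁ p q r) q r)
      where
      regroup : ∀ a q r → (1 + q) * (1 + r) + (1 + q + r) * a ≡ (1 + r) * (1 + a) + q * ((1 + r) + a)
      regroup = solve-∀
    isolate₃ : ∀ p q r → (1 + r) * (1 + arm₁ p q r) + up₂ (λ p q r → (1 + r) + arm₁ p q r) p q r
                 ≡ (1 + arm₁ p q r + arm₂ p q r + up₂ arm₁ p q r) + r * (1 + arm₁ p q r + arm₂ p q r)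
    isolate₃ p q r = trans (cong ((1 + r) * (1 + arm₁ p q r) +_) (suffix-affine N (λ c → χ p c r) (1 + r) (λ c → arm₁ p c r) q))
                     (regroup (arm₁ p q r) (arm₂ p q r) (up₂ arm₁ p q r) r)
      where
      regroup : ∀ a b c r → (1 + r) * (1 + a) + ((1 + r) * b + c) ≡ (1 + a + b + c) + r * (1 + a + b)
      regroup = solve-∀

  mass-cong-on : ∀ {F G} → (∀ {p q r} → χ p q r ≡ 1 → F p q r ≡ G p q r) → mass F ≡ mass G
  mass-cong-on {F} {G} F≡G = ∑³-cong on
    where
    on : ∀ p q r → χ p q r * F p q r ≡ χ p q r * G p q r
    on p q r with χ p q r in χ≡ | χ≤1 p q r
    ... | zero        | _       = refl
    ... | suc zero    | _       = cong (1 *_) (F≡G χ≡)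
    ... | suc (suc _) | s≤s ()

  mass-expand : ∀ Ts → mass (expand Ts) ≡ sum (map (λ T → mass ⟪ T ⟫) Ts)
  mass-expand []       = ∑-zero N λ p _ → ∑-zero N λ q _ → ∑-zero N λ r _ → *-zeroʳ (χ p q r)
  mass-expand (T ∷ Ts) = begin
    ∑³ (λ p q r → χ p q r * (⟪ T ⟫ p q r + expand Ts p q r))        ≡⟨ ∑³-cong (λ p q r → *-distribˡ-+ (χ p q r) _ _) ⟩
    ∑³ (λ p q r → χ p q r * ⟪ T ⟫ p q r + χ p q r * expand Ts p q r) ≡⟨ ∑³-distrib-+ _ _ ⟩
    mass ⟪ T ⟫ + mass (expand Ts)                                     ≡⟨ cong (mass ⟪ T ⟫ +_) (mass-expand Ts) ⟩
    mass ⟪ T ⟫ + sum (map (λ T → mass ⟪ T ⟫) Ts)                      ∎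
    where open ≡-Reasoning

  mass-separable : ∀ A B C → mass ⟪ A , B , C ⟫ ≡ ∑[ p < N ] (A p * ∑[ q < N ] (B q * ∑[ r < N ] (C r * χ p q r)))
  mass-separable A B C = trans (∑³-cong λ p q r → inside (χ p q r) (A p) (B q) (C r)) (∑³-separable A B C χ)
    where
    inside : ∀ x a b c → x * (a * (b * c)) ≡ a * (b * (c * x))
    inside = solve-∀

  module _ {i j k} (x∈ : χ i j k ≡ 1) where

    private
      i+j+k<N : i + j + k < N
      i+j+k<N = ≰⇒> λ N≤ → 0≢1+n (trans (sym (χ-bounded N≤)) x∈)

      i<N : i < N
      i<N = proj₁ (coordinates< i j k i+j+k<N)

      j<N : j < N
      j<N = proj₁ (proj₂ (coordinates< i j k i+j+k<N))

      k<N : k < N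
      k<N = proj₂ (proj₂ (coordinates< i j k i+j+k<N))

      χ-below : ∀ {p q r} → p ≤ i → q ≤ j → r ≤ k → χ p q r ≡ 1
      χ-below p≤i q≤j r≤k = ≤-antisym (χ≤1 _ _ _) (subst (_≤ χ _ _ _) x∈ (χ-antitone p≤i q≤j r≤k))

      corner : mass ⟪ ⟦_≐ i ⟧ , ⟦_≐ j ⟧ , ⟦_≐ k ⟧ ⟫ ≡ 1
      corner = trans (mass-separable ⟦_≐ i ⟧ ⟦_≐ j ⟧ ⟦_≐ k ⟧)
        (trans (∑-point N i _ i<N) (trans (∑-point N j _ j<N) (trans (∑-point N k _ k<N) x∈)))

      arm-i : mass ⟪ ⟦ i <_⟧ , ⟦_≐ j ⟧ , ⟦_≐ k ⟧ ⟫ ≡ arm₁ i j k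
      arm-i = trans (mass-separable ⟦ i <_⟧ ⟦_≐ j ⟧ ⟦_≐ k ⟧) (∑-cong N λ p _ → cong (⟦ i < p ⟧ *_)
        (trans (∑-point N j _ j<N) (trans (∑-point N k _ k<N) (sym (*-identityʳ (χ p j k))))))

      arm-j : mass ⟪ ⟦_≐ i ⟧ , ⟦ j <_⟧ , ⟦_≐ k ⟧ ⟫ ≡ arm₂ i j k
      arm-j = trans (mass-separable ⟦_≐ i ⟧ ⟦ j <_⟧ ⟦_≐ k ⟧) (trans (∑-point N i _ i<N)
        (∑-cong N λ q _ → cong (⟦ j < q ⟧ *_) (trans (∑-point N k _ k<N) (sym (*-identityʳ (χ i q k))))))

      arm-k : mass ⟪ ⟦_≐ i ⟧ , ⟦_≐ j ⟧ , ⟦ k <_⟧ ⟫ ≡ arm₃ i j k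
      arm-k = trans (mass-separable ⟦_≐ i ⟧ ⟦_≐ j ⟧ ⟦ k <_⟧) (trans (∑-point N i _ i<N) (trans (∑-point N j _ j<N)
        (∑-cong N λ r _ → cong (⟦ k < r ⟧ *_) (sym (*-identityʳ (χ i j r))))))

    mass-RHook : mass (λ p q r → 𝟙 (does (RHook? (i , j , k) (p , q , r)))) ≡ R-value i j k
    mass-RHook = begin
      mass (λ p q r → 𝟙 (does (RHook? (i , j , k) (p , q , r)))) ≡⟨ mass-cong (𝟙-RHook (i , j , k)) ⟩
      mass (expand (R-pieces (i , j , k)))                         ≡⟨ mass-expand (R-pieces (i , j , k)) ⟩
      sum (map (λ T → mass ⟪ T ⟫) (R-pieces (i , j , k)))
        ≡⟨ cong sum (Pointwise-≡⇒≡ (corner ∷ arm-i ∷ arm-j ∷ arm-k ∷ [])) ⟩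
      sum (1 ∷ arm₁ i j k ∷ arm₂ i j k ∷ arm₃ i j k ∷ [])
        ≡⟨ sum-of-pieces (arm₁ i j k) (arm₂ i j k) (arm₃ i j k) ⟩
      R-value i j k                                                ∎
      where
      open ≡-Reasoning
      sum-of-pieces : ∀ a b c → 1 + (a + (b + (c + 0))) ≡ suc (a + b + c)
      sum-of-pieces = solve-∀

    mass-R*Hook : mass (λ p q r → 𝟙 (does (R*Hook? (i , j , k) (p , q , r)))) ≡ R*-value i j k
    mass-R*Hook = begin
      mass (λ p q r → 𝟙 (does (R*Hook? (i , j , k) (p , q , r)))) ≡⟨ mass-cong (𝟙-R*Hook (i , j , k)) ⟩
      mass (expand (R*-pieces (i , j , k)))                         ≡⟨ mass-expand (R*-pieces (i , j , k)) ⟩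
      sum (map (λ T → mass ⟪ T ⟫) (R*-pieces (i , j , k)))
        ≡⟨ cong sum (Pointwise-≡⇒≡ (corner ∷ below-i ∷ below-j ∷ below-k ∷ [])) ⟩
      sum (1 ∷ i * 1 ∷ j * 1 ∷ k * 1 ∷ [])                          ≡⟨ sum-of-pieces i j k ⟩
      R*-value i j k                                                ∎
      where
      open ≡-Reasoning
      sum-of-pieces : ∀ a b c → 1 + (a * 1 + (b * 1 + (c * 1 + 0))) ≡ suc (a + b + c)
      sum-of-pieces = solve-∀
      below-i : mass ⟪ ⟦_< i ⟧ , ⟦_≐ j ⟧ , ⟦_≐ k ⟧ ⟫ ≡ i * 1
      below-i = trans (mass-separable ⟦_< i ⟧ ⟦_≐ j ⟧ ⟦_≐ k ⟧) (∑-below N i _ 1 (<⇒≤ i<N) λ p p<i →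
        trans (∑-point N j _ j<N) (trans (∑-point N k _ k<N) (χ-below (<⇒≤ p<i) ≤-refl ≤-refl)))
      below-j : mass ⟪ ⟦_≐ i ⟧ , ⟦_< j ⟧ , ⟦_≐ k ⟧ ⟫ ≡ j * 1
      below-j = trans (mass-separable ⟦_≐ i ⟧ ⟦_< j ⟧ ⟦_≐ k ⟧) (trans (∑-point N i _ i<N)
        (∑-below N j _ 1 (<⇒≤ j<N) λ q q<j → trans (∑-point N k _ k<N) (χ-below ≤-refl (<⇒≤ q<j) ≤-refl)))
      below-k : mass ⟪ ⟦_≐ i ⟧ , ⟦_≐ j ⟧ , ⟦_< k ⟧ ⟫ ≡ k * 1
      below-k = trans (mass-separable ⟦_≐ i ⟧ ⟦_≐ j ⟧ ⟦_< k ⟧) (trans (∑-point N i _ i<N) (trans (∑-point N j _ j<N)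
        (∑-below N k _ 1 (<⇒≤ k<N) λ r r<k → χ-below ≤-refl ≤-refl (<⇒≤ r<k))))

    mass-Q*Hook : mass (λ p q r → 𝟙 (does (Q*Hook? (i , j , k) (p , q , r)))) ≡ Q*-value i j k
    mass-Q*Hook = begin
      mass (λ p q r → 𝟙 (does (Q*Hook? (i , j , k) (p , q , r)))) ≡⟨ mass-cong (𝟙-Q*Hook (i , j , k)) ⟩
      mass (expand (Q*-pieces (i , j , k)))                         ≡⟨ mass-expand (Q*-pieces (i , j , k)) ⟩
      sum (map (λ T → mass ⟪ T ⟫) (Q*-pieces (i , j , k)))
        ≡⟨ cong sum (Pointwise-≡⇒≡ (face-k ∷ face-i ∷ face-j ∷ [])) ⟩
      sum (suc i * (suc j * 1) ∷ suc j * (k * 1) ∷ i * (k * 1) ∷ []) ≡⟨ sum-of-pieces i j k ⟩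
      Q*-value i j k                                                ∎
      where
      open ≡-Reasoning
      sum-of-pieces : ∀ a b c → suc a * (suc b * 1) + (suc b * (c * 1) + (a * (c * 1) + 0)) ≡ 1 + a + b + c + a * b + a * c + b * c
      sum-of-pieces = solve-∀
      face-k : mass ⟪ ⟦_≤ i ⟧ , ⟦_≤ j ⟧ , ⟦_≐ k ⟧ ⟫ ≡ suc i * (suc j * 1)
      face-k = trans (mass-separable ⟦_≤ i ⟧ ⟦_≤ j ⟧ ⟦_≐ k ⟧) (∑-atOrBelow N i _ _ i<N λ p p≤i →
        ∑-atOrBelow N j _ 1 j<N λ q q≤j → trans (∑-point N k _ k<N) (χ-below p≤i q≤j ≤-refl))
      face-i : mass ⟪ ⟦_≐ i ⟧ , ⟦_≤ j ⟧ , ⟦_< k ⟧ ⟫ ≡ suc j * (k * 1)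
      face-i = trans (mass-separable ⟦_≐ i ⟧ ⟦_≤ j ⟧ ⟦_< k ⟧) (trans (∑-point N i _ i<N)
        (∑-atOrBelow N j _ _ j<N λ q q≤j → ∑-below N k _ 1 (<⇒≤ k<N) λ r r<k → χ-below ≤-refl q≤j (<⇒≤ r<k)))
      face-j : mass ⟪ ⟦_< i ⟧ , ⟦_≐ j ⟧ , ⟦_< k ⟧ ⟫ ≡ i * (k * 1)
      face-j = trans (mass-separable ⟦_< i ⟧ ⟦_≐ j ⟧ ⟦_< k ⟧) (∑-below N i _ _ (<⇒≤ i<N) λ p p<i →
        trans (∑-point N j _ j<N) (∑-below N k _ 1 (<⇒≤ k<N) λ r r<k → χ-below (<⇒≤ p<i) ≤-refl (<⇒≤ r<k)))

    mass-QHook : mass (λ p q r → 𝟙 (does (QHook? (i , j , k) (p , q , r)))) ≡ Q-value i j k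
    mass-QHook = begin
      mass (λ p q r → 𝟙 (does (QHook? (i , j , k) (p , q , r)))) ≡⟨ mass-cong (𝟙-QHook (i , j , k)) ⟩
      mass (expand (Q-pieces (i , j , k)))                         ≡⟨ mass-expand (Q-pieces (i , j , k)) ⟩
      sum (map (λ T → mass ⟪ T ⟫) (Q-pieces (i , j , k)))
        ≡⟨ cong sum (Pointwise-≡⇒≡ (corner ∷ arm-i ∷ arm-j ∷ quadrant-k ∷ arm-k ∷ quadrant-j ∷ quadrant-i ∷ [])) ⟩
      sum (1 ∷ arm₁ i j k ∷ arm₂ i j k ∷ up₂ arm₁ i j k ∷ arm₃ i j k ∷ up₃ arm₁ i j k ∷ up₃ arm₂ i j k ∷ [])
        ≡⟨ sum-of-pieces (arm₁ i j k) (arm₂ i j k) (up₂ arm₁ i j k) (arm₃ i j k) (up₃ arm₁ i j k) (up₃ arm₂ i j k) ⟩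
      (1 + arm₁ i j k + arm₂ i j k + up₂ arm₁ i j k) + (arm₃ i j k + up₃ arm₁ i j k + up₃ arm₂ i j k)
        ≡⟨ cong ((1 + arm₁ i j k + arm₂ i j k + up₂ arm₁ i j k) +_) up₃-split ⟨
      Q-value i j k ∎
      where
      open ≡-Reasoning
      sum-of-pieces : ∀ a b c d e f → 1 + (a + (b + (c + (d + (e + (f + 0)))))) ≡ (1 + a + b + c) + (d + e + f)
      sum-of-pieces = solve-∀
      up₃-split : up₃ (λ p q r → 1 + arm₁ p q r + arm₂ p q r) i j k ≡ arm₃ i j k + up₃ arm₁ i j k + up₃ arm₂ i j k
      up₃-split = trans (suffix-distrib-+ N (χ i j) (λ r → 1 + arm₁ i j r) (arm₂ i j) k)
                        (cong (_+ up₃ arm₂ i j k) (suffix-distrib-+ N (χ i j) (λ _ → 1) (arm₁ i j) k))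
      quadrant-k : mass ⟪ ⟦ i <_⟧ , ⟦ j <_⟧ , ⟦_≐ k ⟧ ⟫ ≡ up₂ arm₁ i j k
      quadrant-k = trans (mass-separable ⟦ i <_⟧ ⟦ j <_⟧ ⟦_≐ k ⟧)
        (trans (∑-cong N λ p _ → cong (⟦ i < p ⟧ *_) (∑-cong N λ q _ → cong (⟦ j < q ⟧ *_) (∑-point N k _ k<N)))
               (sym (∑-suffix-plane N i j (λ a b → χ a b k)
                      (λ _ i<a → χ-antitone (<⇒≤ i<a) ≤-refl ≤-refl) (λ b → χ≤1 i b k))))
      quadrant-j : mass ⟪ ⟦ i <_⟧ , ⟦_≐ j ⟧ , ⟦ k <_⟧ ⟫ ≡ up₃ arm₁ i j k
      quadrant-j = trans (mass-separable ⟦ i <_⟧ ⟦_≐ j ⟧ ⟦ k <_⟧)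
        (trans (∑-cong N λ p _ → cong (⟦ i < p ⟧ *_) (∑-point N j _ j<N))
               (sym (∑-suffix-plane N i k (λ a b → χ a j b)
                      (λ _ i<a → χ-antitone (<⇒≤ i<a) ≤-refl ≤-refl) (λ b → χ≤1 i j b))))
      quadrant-i : mass ⟪ ⟦_≐ i ⟧ , ⟦ j <_⟧ , ⟦ k <_⟧ ⟫ ≡ up₃ arm₂ i j k
      quadrant-i = trans (mass-separable ⟦_≐ i ⟧ ⟦ j <_⟧ ⟦ k <_⟧)
        (trans (∑-point N i _ i<N)
               (sym (∑-suffix-plane N j k (λ a b → χ i a b)
                      (λ _ j<a → χ-antitone ≤-refl (<⇒≤ j<a) ≤-refl) (λ b → χ≤1 i j b))))

-- The indicator of a solid partition

_≟ᶜ_ : DecidableEquality Cell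
(p , q , r) ≟ᶜ (a , b , c) = map′ to from ((p ≟ a) ×-dec (q ≟ b) ×-dec (r ≟ c))
  where
  to : p ≡ a × q ≡ b × r ≡ c → (p , q , r) ≡ (a , b , c)
  to (refl , refl , refl) = refl
  from : (p , q , r) ≡ (a , b , c) → p ≡ a × q ≡ b × r ≡ c
  from refl = refl , refl , refl

_∈?_ : ∀ x xs → Dec (x ∈ xs)
x ∈? xs = any? (x ≟ᶜ_) xs

𝟙-∧ : ∀ x y → 𝟙 (x ∧ y) ≡ 𝟙 x * 𝟙 y
𝟙-∧ true  y = sym (+-identityʳ (𝟙 y))
𝟙-∧ false y = refl

𝟙-≟ᶜ : ∀ p q r a b c → 𝟙 (does ((p , q , r) ≟ᶜ (a , b , c))) ≡ ⟦ p ≐ a ⟧ * (⟦ q ≐ b ⟧ * ⟦ r ≐ c ⟧)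
𝟙-≟ᶜ p q r a b c = trans (𝟙-∧ (p ≡ᵇ a) _) (cong (⟦ p ≐ a ⟧ *_) (𝟙-∧ (q ≡ᵇ b) (r ≡ᵇ c)))

𝟙-∨ : ∀ x y → (T x → T y → ⊥) → 𝟙 (x ∨ y) ≡ 𝟙 x + 𝟙 y
𝟙-∨ true  true  disjoint = ⊥-elim (disjoint _ _)
𝟙-∨ true  false _        = refl
𝟙-∨ false y     _        = refl

does⇒ : ∀ {P : Set} (P? : Dec P) → T (does P?) → P
does⇒ (yes p) _ = p

𝟙-∈-∷ : ∀ x {y ys} → y ∉ ys → 𝟙 (does (x ∈? (y ∷ ys))) ≡ 𝟙 (does (x ≟ᶜ y)) + 𝟙 (does (x ∈? ys))
𝟙-∈-∷ x {y} {ys} y∉ys = 𝟙-∨ (does (x ≟ᶜ y)) (does (x ∈? ys))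
  λ x≡y x∈ys → y∉ys (subst (_∈ ys) (does⇒ (x ≟ᶜ y) x≡y) (does⇒ (x ∈? ys) x∈ys))

length-filter≡sum : ∀ {P : Cell → Set} (P? : ∀ y → Dec (P y)) xs →
  length (filter P? xs) ≡ sum (map (λ y → 𝟙 (does (P? y))) xs)
length-filter≡sum P? []       = refl
length-filter≡sum P? (x ∷ xs) with does (P? x)
... | true  = cong suc (length-filter≡sum P? xs)
... | false = length-filter≡sum P? xs

size : List Cell → ℕ
size []                = 0
size ((i , j , k) ∷ xs) = suc (i + j + k) + size xs

∈⇒<size : ∀ {i j k xs} → (i , j , k) ∈ xs → i + j + k < size xs
∈⇒<size {xs = _ ∷ xs} (here refl) = m≤m+n _ (size xs)
∈⇒<size {xs = (a , b , c) ∷ xs} (there x∈) = ≤-trans (∈⇒<size x∈) (m≤n+m (size xs) (suc (a + b + c)))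

RHook⇒R*Hook : ∀ {x y} → RHook x y → R*Hook y x
RHook⇒R*Hook (inj₁ (e₁ , e₂ , le))        = inj₁ (sym e₁ , sym e₂ , le)
RHook⇒R*Hook (inj₂ (inj₁ (e₁ , e₂ , le))) = inj₂ (inj₁ (sym e₁ , sym e₂ , le))
RHook⇒R*Hook (inj₂ (inj₂ (e₁ , e₂ , le))) = inj₂ (inj₂ (sym e₁ , sym e₂ , le))

R*Hook⇒RHook : ∀ {x y} → R*Hook y x → RHook x y
R*Hook⇒RHook (inj₁ (e₁ , e₂ , le))        = inj₁ (sym e₁ , sym e₂ , le)
R*Hook⇒RHook (inj₂ (inj₁ (e₁ , e₂ , le))) = inj₂ (inj₁ (sym e₁ , sym e₂ , le))
R*Hook⇒RHook (inj₂ (inj₂ (e₁ , e₂ , le))) = inj₂ (inj₂ (sym e₁ , sym e₂ , le))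

QHook⇒Q*Hook : ∀ {x y} → QHook x y → Q*Hook y x
QHook⇒Q*Hook (inj₁ (e , le₁ , le₂))        = inj₁ (sym e , le₁ , le₂)
QHook⇒Q*Hook (inj₂ (inj₁ (e , le₁ , le₂))) = inj₂ (inj₁ (sym e , le₁ , le₂))
QHook⇒Q*Hook (inj₂ (inj₂ (e , le₁ , le₂))) = inj₂ (inj₂ (sym e , le₁ , le₂))

Q*Hook⇒QHook : ∀ {x y} → Q*Hook y x → QHook x y
Q*Hook⇒QHook (inj₁ (e , le₁ , le₂))        = inj₁ (sym e , le₁ , le₂)
Q*Hook⇒QHook (inj₂ (inj₁ (e , le₁ , le₂))) = inj₂ (inj₁ (sym e , le₁ , le₂))
Q*Hook⇒QHook (inj₂ (inj₂ (e , le₁ , le₂))) = inj₂ (inj₂ (sym e , le₁ , le₂))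

module Indicator (Λ : SolidPartition) where

  χ : ℕ → ℕ → ℕ → ℕ
  χ p q r = 𝟙 (does ((p , q , r) ∈? cells Λ))

  N : ℕ
  N = size (cells Λ)

  χ≤1 : ∀ p q r → χ p q r ≤ 1
  χ≤1 p q r = 𝟙≤1 _

  χ-antitone : Antitone³ χ
  χ-antitone {p} {q} {r} {p′} {q′} {r′} p≤p′ q≤q′ r≤r′ with (p′ , q′ , r′) ∈? cells Λ
  ... | no  _  = z≤n
  ... | yes x∈ = ≤-reflexive (cong 𝟙 (sym (dec-true ((p , q , r) ∈? cells Λ) (lower Λ x∈ (p≤p′ , q≤q′ , r≤r′)))))

  χ-bounded : ∀ {p q r} → N ≤ p + q + r → χ p q r ≡ 0
  χ-bounded {p} {q} {r} N≤ = cong 𝟙 (dec-false ((p , q , r) ∈? cells Λ) λ x∈ → <⇒≱ (∈⇒<size x∈) N≤)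

  open Downset N χ χ≤1 χ-antitone χ-bounded public
  open Cube N

  sum-as-∑³ : ∀ (F : Cell → ℕ) ys → Unique ys → (∀ {y} → y ∈ ys → y ∈ cells Λ) →
    sum (map F ys) ≡ ∑³ (λ p q r → 𝟙 (does ((p , q , r) ∈? ys)) * F (p , q , r))
  sum-as-∑³ F []                 _                _   = sym (∑-zero N λ _ _ → ∑-zero N λ _ _ → ∑-zero N λ _ _ → refl)
  sum-as-∑³ F ((a , b , c) ∷ ys) (y∉ys ∷ unique) ys⊆ = begin
    F (a , b , c) + sum (map F ys)
      ≡⟨ cong₂ _+_ (sym (∑³-point (λ p q r → F (p , q , r)) a<N b<N c<N))
                   (sum-as-∑³ F ys unique (λ y∈ → ys⊆ (there y∈))) ⟩
    ∑³ (λ p q r → ⟦ p ≐ a ⟧ * (⟦ q ≐ b ⟧ * (⟦ r ≐ c ⟧ * F (p , q , r))))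
      + ∑³ (λ p q r → 𝟙 (does ((p , q , r) ∈? ys)) * F (p , q , r))
      ≡⟨ ∑³-distrib-+ _ _ ⟨
    ∑³ (λ p q r → ⟦ p ≐ a ⟧ * (⟦ q ≐ b ⟧ * (⟦ r ≐ c ⟧ * F (p , q , r)))
                  + 𝟙 (does ((p , q , r) ∈? ys)) * F (p , q , r))
      ≡⟨ ∑³-cong (λ p q r → split p q r) ⟨
    ∑³ (λ p q r → 𝟙 (does ((p , q , r) ∈? ((a , b , c) ∷ ys))) * F (p , q , r)) ∎
    where
    open ≡-Reasoning
    a<N : a < N
    a<N = proj₁ (coordinates< a b c (∈⇒<size (ys⊆ (here refl))))
    b<N : b < N
    b<N = proj₁ (proj₂ (coordinates< a b c (∈⇒<size (ys⊆ (here refl)))))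
    c<N : c < N
    c<N = proj₂ (proj₂ (coordinates< a b c (∈⇒<size (ys⊆ (here refl)))))
    split : ∀ p q r → 𝟙 (does ((p , q , r) ∈? ((a , b , c) ∷ ys))) * F (p , q , r)
      ≡ ⟦ p ≐ a ⟧ * (⟦ q ≐ b ⟧ * (⟦ r ≐ c ⟧ * F (p , q , r))) + 𝟙 (does ((p , q , r) ∈? ys)) * F (p , q , r)
    split p q r = begin
      𝟙 (does ((p , q , r) ∈? ((a , b , c) ∷ ys))) * F (p , q , r)
        ≡⟨ cong (_* F (p , q , r)) (𝟙-∈-∷ (p , q , r) (All¬⇒¬Any y∉ys)) ⟩
      (𝟙 (does ((p , q , r) ≟ᶜ (a , b , c))) + 𝟙 (does ((p , q , r) ∈? ys))) * F (p , q , r)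
        ≡⟨ *-distribʳ-+ (F (p , q , r)) (𝟙 (does ((p , q , r) ≟ᶜ (a , b , c)))) (𝟙 (does ((p , q , r) ∈? ys))) ⟩
      𝟙 (does ((p , q , r) ≟ᶜ (a , b , c))) * F (p , q , r) + 𝟙 (does ((p , q , r) ∈? ys)) * F (p , q , r)
        ≡⟨ cong (λ x → x * F (p , q , r) + 𝟙 (does ((p , q , r) ∈? ys)) * F (p , q , r)) (𝟙-≟ᶜ p q r a b c) ⟩
      ⟦ p ≐ a ⟧ * (⟦ q ≐ b ⟧ * ⟦ r ≐ c ⟧) * F (p , q , r) + 𝟙 (does ((p , q , r) ∈? ys)) * F (p , q , r)
        ≡⟨ cong (_+ 𝟙 (does ((p , q , r) ∈? ys)) * F (p , q , r))
             (trans (*-assoc ⟦ p ≐ a ⟧ _ _) (cong (⟦ p ≐ a ⟧ *_) (*-assoc ⟦ q ≐ b ⟧ _ _))) ⟩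
      ⟦ p ≐ a ⟧ * (⟦ q ≐ b ⟧ * (⟦ r ≐ c ⟧ * F (p , q , r))) + 𝟙 (does ((p , q , r) ∈? ys)) * F (p , q , r) ∎

  sum-as-mass : ∀ (F : Cell → ℕ) → sum (map F (cells Λ)) ≡ mass (λ p q r → F (p , q , r))
  sum-as-mass F = sum-as-∑³ F (cells Λ) (unique Λ) (λ y∈ → y∈)

  count-as-mass : ∀ {P : Cell → Set} (P? : ∀ y → Dec (P y)) → count Λ P P? ≡ mass (λ p q r → 𝟙 (does (P? (p , q , r))))
  count-as-mass P? = trans (length-filter≡sum P? (cells Λ)) (sum-as-mass _)

  excess-as-mass : ∀ t (f : Cell → ℕ) G → (∀ {p q r} → χ p q r ≡ 1 → f (p , q , r) ≡ G p q r) →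
    excess t (map f (cells Λ)) ≡ excess³ t G
  excess-as-mass t f G f≡G = begin
    sum (map (_∸ t) (map f (cells Λ)))      ≡⟨ cong sum (map-∘ (cells Λ)) ⟨
    sum (map (λ x → f x ∸ t) (cells Λ))     ≡⟨ sum-as-mass (λ x → f x ∸ t) ⟩
    mass (λ p q r → f (p , q , r) ∸ t)      ≡⟨ mass-cong-on (λ x∈ → cong (_∸ t) (f≡G x∈)) ⟩
    excess³ t G                             ∎
    where open ≡-Reasoning

  sum-count-converse : ∀ {H H′ : Cell → Cell → Set} (H? : ∀ x y → Dec (H x y)) (H′? : ∀ x y → Dec (H′ x y)) →
    (∀ {x y} → H x y → H′ y x) → (∀ {x y} → H′ y x → H x y) →
    sum (map (λ x → count Λ (H x) (H? x)) (cells Λ)) ≡ sum (map (λ y → count Λ (H′ y) (H′? y)) (cells Λ))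
  sum-count-converse H? H′? to from = begin
    sum (map (λ x → length (filter (H? x) (cells Λ))) (cells Λ))
      ≡⟨ cong sum (map-cong (λ x → length-filter≡sum (H? x) (cells Λ)) (cells Λ)) ⟩
    sum (map (λ x → sum (map (λ y → 𝟙 (does (H? x y))) (cells Λ))) (cells Λ))
      ≡⟨ sum-map-comm (λ x y → 𝟙 (does (H? x y))) (cells Λ) (cells Λ) ⟩
    sum (map (λ y → sum (map (λ x → 𝟙 (does (H? x y))) (cells Λ))) (cells Λ))
      ≡⟨ cong sum (map-cong (λ y → cong sum (map-cong (λ x → converse x y) (cells Λ))) (cells Λ)) ⟩
    sum (map (λ y → sum (map (λ x → 𝟙 (does (H′? y x))) (cells Λ))) (cells Λ))
      ≡⟨ cong sum (map-cong (λ y → length-filter≡sum (H′? y) (cells Λ)) (cells Λ)) ⟨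
    sum (map (λ y → length (filter (H′? y) (cells Λ))) (cells Λ)) ∎
    where
    open ≡-Reasoning
    converse : ∀ x y → 𝟙 (does (H? x y)) ≡ 𝟙 (does (H′? y x))
    converse x y = cong 𝟙 (does-⇔ (mk⇔ to from) (H? x y) (H′? y x))

  hook-majorization : ∀ {H H′ : Cell → Cell → Set} (H? : ∀ x y → Dec (H x y)) (H′? : ∀ x y → Dec (H′ x y)) →
    (∀ {x y} → H x y → H′ y x) → (∀ {x y} → H′ y x → H x y) →
    ∀ (G G′ : ℕ → ℕ → ℕ → ℕ) →
    (∀ {i j k} → χ i j k ≡ 1 → mass (λ p q r → 𝟙 (does (H? (i , j , k) (p , q , r)))) ≡ G i j k) →
    (∀ {i j k} → χ i j k ≡ 1 → mass (λ p q r → 𝟙 (does (H′? (i , j , k) (p , q , r)))) ≡ G′ i j k) →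
    (∀ t → excess³ t G′ ≤ excess³ t G) →
    Majorizes (map (λ x → count Λ (H x) (H? x)) (cells Λ)) (map (λ y → count Λ (H′ y) (H′? y)) (cells Λ))
  hook-majorization H? H′? to from G G′ mass-H mass-H′ excess≤ =
    majorizes-by-excess _ _
      (trans (length-map _ (cells Λ)) (sym (length-map _ (cells Λ))))
      (sum-count-converse H? H′? to from)
      λ t → subst₂ _≤_ (sym (excess-as-mass t _ G′ λ x∈ → trans (count-as-mass (H′? _)) (mass-H′ x∈)))
                       (sym (excess-as-mass t _ G  λ x∈ → trans (count-as-mass (H? _)) (mass-H x∈)))
                       (excess≤ t)

theorem5p1 : (Λ : SolidPartition) →
    Majorizes (multiset Λ (R Λ)) (multiset Λ (R* Λ)) ×
    Majorizes (multiset Λ (Q Λ)) (multiset Λ (Q* Λ))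
theorem5p1 Λ =
  hook-majorization RHook? R*Hook? RHook⇒R*Hook R*Hook⇒RHook R-value R*-value mass-RHook mass-R*Hook excess-R*≤R ,
  hook-majorization QHook? Q*Hook? QHook⇒Q*Hook Q*Hook⇒QHook Q-value Q*-value mass-QHook mass-Q*Hook excess-Q*≤Q
  where open Indicator Λ
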